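{- For $n\ge2$ and $2\le i\le n$ let $a_{n,i}=\sum_\pi y^{\mu(\pi)}$, the sum over all $\pi\in\mathcal{D}_{31\text{ - }2}(n)$ whose flattened form has second letter $i$, and let $A(x,v)=\sum_{n\ge2}\big(\sum_{i=2}^na_{n,i}v^{i-2}\big)x^n$. Then $$(1-v+xv^2)A(x,v)=x^2y(1-v)+x(1+xy-xyv^2)A(x,1).$$
   Context: Every permutation $\pi$ of $[n]=\{1,\dots,n\}$ is written in standard cycle form: each cycle is written starting with its smallest element, and the cycles are ordered from left to right by increasing first elements. The flattened form $\mathrm{flat}(\pi)$ is the word (in one-line notation) obtained by erasing the parentheses of the standard cycle form. A derangement is a permutation with no fixed points; $\mathcal{D}(n)$ is the set of derangements of $[n]$, and $\mu(\pi)$ denotes the number of cycles of $\pi$. A word $w=w_1\cdots w_n$ of distinct integers contains the vincular pattern $31\text{ - }2$ if there are indices $i$ and $k>i+1$ with $w_{i+1}<w_k<w_i$, and avoids it otherwise. $\mathcal{D}_{31\text{ - }2}(n)$ is the set of $\pi\in\mathcal{D}(n)$ such that $\mathrm{flat}(\pi)$ avoids $31\text{ - }2$. Identities are of formal power series in $x$ with coefficients polynomials in $v,y$. -}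

module Defs where

open import Data.Nat using (ℕ; zero; suc; _∸_; _≡ᵇ_; _<ᵇ_; _≤ᵇ_)
open import Data.Bool using (Bool; true; false; _∧_; not; if_then_else_)
open import Data.List using (List; []; _∷_; map; length; concatMap; upTo; filterᵇ)
open import Data.Bool.ListAction using (all; any)
open import Data.Integer using (ℤ; +_) renaming (_+_ to _+ℤ_; _*_ to _*ℤ_; -_ to -ℤ_)

-- Permutations of [n] = {1,…,n}, in one-line notation w = π(1) π(2) … π(n)

range1 : ℕ → List ℕ
range1 n = map suc (upTo n)

words : ℕ → ℕ → List (List ℕ)
words n zero = [] ∷ []
words n (suc m) = concatMap (λ a → map (a ∷_) (words n m)) (range1 n)

distinct : List ℕ → Bool
distinct [] = true
distinct (a ∷ w) = not (any (a ≡ᵇ_) w) ∧ distinct w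

perms : ℕ → List (List ℕ)
perms n = filterᵇ distinct (words n n)

-- 0-indexed lookup with default 0
nth : List ℕ → ℕ → ℕ
nth [] _ = 0
nth (a ∷ w) zero = a
nth (a ∷ w) (suc i) = nth w i

-- π(j) for the permutation with one-line word w (1-indexed)
app : List ℕ → ℕ → ℕ
app w j = nth w (j ∸ 1)

-- the cycle of π containing i, written starting at i: i, π(i), π²(i), …
-- (fuel length w suffices since every cycle has length ≤ n)
orbit : List ℕ → ℕ → List ℕ
orbit w i = i ∷ go (length w) (app w i)
  where
  go : ℕ → ℕ → List ℕ
  go zero _ = []
  go (suc f) j = if j ≡ᵇ i then [] else j ∷ go f (app w j)

isLeader : List ℕ → ℕ → Bool
isLeader w i = all (i ≤ᵇ_) (orbit w i)

leaders : List ℕ → List ℕ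
leaders w = filterᵇ (isLeader w) (range1 (length w))

flat : List ℕ → List ℕ
flat w = concatMap (orbit w) (leaders w)

μ : List ℕ → ℕ
μ w = length (leaders w)

isDerangement : List ℕ → Bool
isDerangement w = all (λ i → not (app w i ≡ᵇ i)) (range1 (length w))

avoids31-2 : List ℕ → Bool
avoids31-2 [] = true
avoids31-2 (a ∷ []) = true
avoids31-2 (a ∷ b ∷ rest) =
  not (any (λ c → (b <ᵇ c) ∧ (c <ᵇ a)) rest) ∧ avoids31-2 (b ∷ rest)

secondLetter : List ℕ → ℕ
secondLetter w = nth (flat w) 1

-- number of π ∈ D_{31-2}(n) with second letter of flat(π) equal to i and μ(π) = k
-- (= coefficient of y^k in a_{n,i})
aCoeff : ℕ → ℕ → ℕ → ℕ
aCoeff n i k = length (filterᵇ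
  (λ w → isDerangement w ∧ avoids31-2 (flat w) ∧ (secondLetter w ≡ᵇ i) ∧ (μ w ≡ᵇ k))
  (perms n))

-- Formal power series in x with coefficients polynomials in v, y (over ℤ),
-- represented by coefficient extraction: F n j k = [x^n v^j y^k] F.

Series : Set
Series = ℕ → ℕ → ℕ → ℤ

Σ≤ : ℕ → (ℕ → ℤ) → ℤ
Σ≤ n f = Data.List.foldr _+ℤ_ (+ 0) (map f (upTo (suc n)))

𝟙 : Series
𝟙 zero zero zero = + 1
𝟙 _ _ _ = + 0

X : Series
X (suc zero) zero zero = + 1
X _ _ _ = + 0

V : Series
V zero (suc zero) zero = + 1
V _ _ _ = + 0

Y : Series
Y zero zero (suc zero) = + 1
Y _ _ _ = + 0

infixl 6 _⊕_ _⊟_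
infixl 7 _⊛_

_⊕_ : Series → Series → Series
(F ⊕ G) n j k = F n j k +ℤ G n j k

_⊟_ : Series → Series → Series
(F ⊟ G) n j k = F n j k +ℤ (-ℤ G n j k)

_⊛_ : Series → Series → Series
(F ⊛ G) n j k =
  Σ≤ n λ a → Σ≤ j λ b → Σ≤ k λ c → F a b c *ℤ G (n ∸ a) (j ∸ b) (k ∸ c)

A : Series
A zero _ _ = + 0
A (suc zero) _ _ = + 0
A (suc (suc m)) j k = + aCoeff (suc (suc m)) (j Data.Nat.+ 2) k

-- A(x,1): substitute v = 1 (only v^j with j ≤ n-2 occur, so the sum is finite)
A₁ : Series
A₁ n zero k = Σ≤ n λ j → A n j k
A₁ n (suc _) k = + 0

-- A derangement is handled through its standard cycle form, so that its flattened form reads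
-- 1 i c …, where i is the second letter. Avoiding 31-2 forces c ≥ i − 1, since otherwise i c (i − 1)
-- is an occurrence. If the first cycle has at least three elements (always the case for i ≥ 4),
-- deleting i and closing up the letters is a bijection onto the derangements of [n − 1] whose
-- second letter is at least max 2 (i − 1), with the same number of cycles. If the first cycle is
-- the transposition (1 i), so i ∈ {2, 3}, removing it is a bijection onto the derangements of
-- [n − 2] with second letter at least 2 and one cycle fewer. Hence
--   a_{n,i} = Σ_{j ≥ i−1} a_{n−1,j}  (i ≥ 4),   a_{n,2} = a_{n,3} = Σ_{j ≥ 2} a_{n−1,j} + y Σ_{j ≥ 2} a_{n−2,j},
-- and comparing coefficients of xⁿ vʲ yᵏ turns these recurrences into the functional equation.

module Submission where

open import Defs
open import Algebra.Bundles using (CommutativeMonoid)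
open import Data.Bool using (Bool; true; false; _∧_; _∨_; not; if_then_else_; T)
open import Data.Bool.ListAction using (all; any)
open import Data.Bool.Properties
  using (T-≡; ⇔→≡; ∧-conicalˡ; ∧-conicalʳ; ∧-zeroʳ; ∧-distribˡ-∨; ∧-distribʳ-∨; ∧-commutativeMonoid)
open import Data.Empty using (⊥; ⊥-elim)
open import Data.Integer using (ℤ; +_) renaming (_+_ to _+ℤ_; _*_ to _*ℤ_; -_ to -ℤ_)
import Data.Integer.Properties as ℤ
open import Data.Integer.Solver using (module +-*-Solver)
open import Data.List using (List; []; _∷_; map; length; concatMap; concat; upTo; applyUpTo; filterᵇ; foldr; _++_)
open import Data.List.Membership.Propositional using (_∈_; _∉_; find; lose)
open import Data.List.Membership.Propositional.Properties
  using (∈-∃++; ∈-++⁻; ∈-++⁺ˡ; ∈-++⁺ʳ; ∈-map⁺; ∈-map⁻; ∈-filter⁺; ∈-filter⁻; ∈-upTo⁺; ∈-upTo⁻; ∈-applyUpTo⁺; ∈-applyUpTo⁻;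
         ∈-concat⁺′; ∈-concat⁻′; ∈-concatMap⁺; ∈-concatMap⁻)
open import Data.List.Properties
  using (length-map; length-++; length-upTo; length-applyUpTo; ∷-injectiveʳ; map-∘; map-upTo; map-applyUpTo; map-cong; map-++;
         map-cong-local; map-id-local; concat-map)
open import Data.List.Relation.Unary.All as All using (All; []; _∷_)
open import Data.List.Relation.Unary.AllPairs using (AllPairs; []; _∷_)
import Data.List.Relation.Unary.AllPairs.Properties as AllPairs
open import Data.List.Relation.Unary.Any using (here; there)
open import Data.List.Relation.Unary.Unique.Propositional using (Unique)
import Data.List.Relation.Unary.Unique.Propositional.Properties as Unique
open import Data.Nat using (ℕ; zero; suc; pred; _+_; _*_; _∸_; _≤_; _<_; z≤n; s≤s; _≡ᵇ_; _<ᵇ_; _≤ᵇ_; _≟_; _≤?_; _<?_)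
open import Data.Nat.DivMod using (_%_; _/_; m≡m%n+[m/n]*n; m%n<n)
open import Data.Nat.Properties
open import Data.Product using (∃; _×_; _,_; proj₁; proj₂)
open import Data.Sum using (_⊎_; inj₁; inj₂)
open import Function using (_∘_; Equivalence; mk⇔)
open import Relation.Binary.Definitions using (tri<; tri≈; tri>)
open import Relation.Binary.PropositionalEquality
  using (_≡_; _≢_; refl; sym; trans; cong; cong₂; subst; subst₂; module ≡-Reasoning)
open import Relation.Nullary using (¬_; yes; no)
open import Relation.Nullary.Decidable using (T?)

open import Algebra.Properties.CommutativeSemigroup (CommutativeMonoid.commutativeSemigroup ∧-commutativeMonoid)
  using () renaming (interchange to ∧-interchange)
open import Algebra.Properties.CommutativeSemigroup ℤ.+-commutativeSemigroup
  using () renaming (interchange to ℤ-interchange)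
open +-*-Solver using (solve; _:+_; :-_; _:=_; con)

-- Counting

count : ∀ {A : Set} → (A → Bool) → List A → ℕ
count p xs = length (filterᵇ p xs)

∈-filterᵇ⁻ : ∀ {A : Set} (p : A → Bool) {x xs} → x ∈ filterᵇ p xs → x ∈ xs × p x ≡ true
∈-filterᵇ⁻ p m = let (x∈ , px) = ∈-filter⁻ (T? ∘ p) m in x∈ , Equivalence.to T-≡ px

∈-filterᵇ⁺ : ∀ {A : Set} (p : A → Bool) {x xs} → x ∈ xs → p x ≡ true → x ∈ filterᵇ p xs
∈-filterᵇ⁺ p x∈ px = ∈-filter⁺ (T? ∘ p) x∈ (Equivalence.from T-≡ px)

head∉tail : ∀ {A : Set} {x : A} {xs} → Unique (x ∷ xs) → x ∉ xs
head∉tail (x∉ ∷ _) x∈ = All.lookup x∉ x∈ refl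

⊆⇒length-≤ : ∀ {A : Set} (xs ys : List A) → Unique xs → (∀ {x} → x ∈ xs → x ∈ ys) → length xs ≤ length ys
⊆⇒length-≤ [] ys u s = z≤n
⊆⇒length-≤ (x ∷ xs) ys (x∉ ∷ u) s with ∈-∃++ (s (here refl))
... | us , vs , refl = subst (suc (length xs) ≤_) (sym length-removed) (s≤s (⊆⇒length-≤ xs (us ++ vs) u s′))
  where
  length-removed : length (us ++ x ∷ vs) ≡ suc (length (us ++ vs))
  length-removed = trans (length-++ us) (trans (+-suc (length us) (length vs)) (cong suc (sym (length-++ us))))
  s′ : ∀ {z} → z ∈ xs → z ∈ us ++ vs
  s′ z∈ with ∈-++⁻ us (s (there z∈))
  ... | inj₁ z∈us = ∈-++⁺ˡ z∈us
  ... | inj₂ (here refl) = ⊥-elim (All.lookup x∉ z∈ refl)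
  ... | inj₂ (there z∈vs) = ∈-++⁺ʳ us z∈vs

InjectiveOn : ∀ {A B : Set} → (A → B) → List A → Set
InjectiveOn f xs = ∀ {x y} → x ∈ xs → y ∈ xs → f x ≡ f y → x ≡ y

map⁺-unique : ∀ {A B : Set} (f : A → B) xs → Unique xs → InjectiveOn f xs → Unique (map f xs)
map⁺-unique f [] u inj = []
map⁺-unique f (x ∷ xs) (x∉ ∷ u) inj = All.tabulate fx∉ ∷ map⁺-unique f xs u (λ m m′ → inj (there m) (there m′))
  where
  fx∉ : ∀ {z} → z ∈ map f xs → f x ≢ z
  fx∉ z∈ e with ∈-map⁻ f z∈
  ... | y , y∈ , refl = All.lookup x∉ y∈ (inj (here refl) (there y∈) e)

count-≤-byInjection : ∀ {A B : Set} (P : A → Bool) (Q : B → Bool) xs ys → Unique xs → (f : A → B) →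
  (∀ {x} → x ∈ xs → P x ≡ true → f x ∈ ys × Q (f x) ≡ true) →
  InjectiveOn f (filterᵇ P xs) →
  count P xs ≤ count Q ys
count-≤-byInjection P Q xs ys u f maps inj =
  subst (_≤ count Q ys) (length-map f (filterᵇ P xs))
    (⊆⇒length-≤ (map f (filterᵇ P xs)) (filterᵇ Q ys) (map⁺-unique f _ (Unique.filter⁺ (T? ∘ P) u) inj) image⊆)
  where
  image⊆ : ∀ {z} → z ∈ map f (filterᵇ P xs) → z ∈ filterᵇ Q ys
  image⊆ z∈ with ∈-map⁻ f z∈
  ... | x , x∈ , refl = let (x∈xs , px) = ∈-filterᵇ⁻ P x∈ ; (fx∈ , qfx) = maps x∈xs px in ∈-filterᵇ⁺ Q fx∈ qfx

count-≡-byBijection : ∀ {A B : Set} (P : A → Bool) (Q : B → Bool) xs ys → Unique xs → Unique ys →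
  (f : A → B) (g : B → A) →
  (∀ {x} → x ∈ xs → P x ≡ true → f x ∈ ys × Q (f x) ≡ true) →
  (∀ {y} → y ∈ ys → Q y ≡ true → g y ∈ xs × P (g y) ≡ true) →
  (∀ {x} → x ∈ xs → P x ≡ true → g (f x) ≡ x) →
  (∀ {y} → y ∈ ys → Q y ≡ true → f (g y) ≡ y) →
  count P xs ≡ count Q ys
count-≡-byBijection P Q xs ys uxs uys f g f∈ g∈ gf fg =
  ≤-antisym (count-≤-byInjection P Q xs ys uxs f f∈ (cancel P g gf))
            (count-≤-byInjection Q P ys xs uys g g∈ (cancel Q f fg))
  where
  cancel : ∀ {C D : Set} (R : C → Bool) {zs} {h : C → D} (h′ : D → C) →
    (∀ {z} → z ∈ zs → R z ≡ true → h′ (h z) ≡ z) → InjectiveOn h (filterᵇ R zs)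
  cancel R h′ inv m m′ e =
    let (a , ra) = ∈-filterᵇ⁻ R m ; (b , rb) = ∈-filterᵇ⁻ R m′ in
    trans (sym (inv a ra)) (trans (cong h′ e) (inv b rb))

count-∨ : ∀ {A : Set} (Q R : A → Bool) xs → (∀ {x} → x ∈ xs → Q x ≡ true → R x ≡ false) →
  count (λ x → Q x ∨ R x) xs ≡ count Q xs + count R xs
count-∨ Q R [] disj = refl
count-∨ Q R (x ∷ xs) disj with Q x in qx | R x in rx
... | true | true with () ← trans (sym (disj (here refl) qx)) rx
... | true | false = cong suc (count-∨ Q R xs (disj ∘ there))
... | false | true = trans (cong suc (count-∨ Q R xs (disj ∘ there))) (sym (+-suc _ _))
... | false | false = count-∨ Q R xs (disj ∘ there)

count-cong : ∀ {A : Set} (P Q : A → Bool) xs → (∀ {x} → x ∈ xs → P x ≡ Q x) → count P xs ≡ count Q xs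
count-cong P Q [] e = refl
count-cong P Q (x ∷ xs) e with P x in px | Q x in qx
... | true | true = cong suc (count-cong P Q xs (e ∘ there))
... | false | false = count-cong P Q xs (e ∘ there)
... | true | false with () ← trans (sym px) (trans (e (here refl)) qx)
... | false | true with () ← trans (sym px) (trans (e (here refl)) qx)

count-none : ∀ {A : Set} (P : A → Bool) xs → (∀ {x} → x ∈ xs → P x ≡ false) → count P xs ≡ 0
count-none P [] e = refl
count-none P (x ∷ xs) e with P x in px
... | false = count-none P xs (e ∘ there)
... | true with () ← trans (sym px) (e (here refl))

T⇒≡true : ∀ {b} → T b → b ≡ true
T⇒≡true = Equivalence.to T-≡

≡true⇒T : ∀ {b} → b ≡ true → T b
≡true⇒T = Equivalence.from T-≡

true≢false : true ≢ false
true≢false ()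

≢true⇒≡false : ∀ {b} → b ≢ true → b ≡ false
≢true⇒≡false {false} _ = refl
≢true⇒≡false {true} ne = ⊥-elim (ne refl)

≡ᵇ-true⇒≡ : ∀ {m n} → (m ≡ᵇ n) ≡ true → m ≡ n
≡ᵇ-true⇒≡ {m} {n} e = ≡ᵇ⇒≡ m n (≡true⇒T e)

≡ᵇ-refl : ∀ m → (m ≡ᵇ m) ≡ true
≡ᵇ-refl m = T⇒≡true (≡⇒≡ᵇ m m refl)

≢⇒≡ᵇ-false : ∀ {m n} → m ≢ n → (m ≡ᵇ n) ≡ false
≢⇒≡ᵇ-false ne = ≢true⇒≡false (ne ∘ ≡ᵇ-true⇒≡)

≤⇒≤ᵇ-true : ∀ {m n} → m ≤ n → (m ≤ᵇ n) ≡ true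
≤⇒≤ᵇ-true le = T⇒≡true (≤⇒≤ᵇ le)

≤ᵇ-true⇒≤ : ∀ {m n} → (m ≤ᵇ n) ≡ true → m ≤ n
≤ᵇ-true⇒≤ {m} {n} e = ≤ᵇ⇒≤ m n (≡true⇒T e)

>⇒≤ᵇ-false : ∀ {m n} → n < m → (m ≤ᵇ n) ≡ false
>⇒≤ᵇ-false lt = ≢true⇒≡false (<⇒≱ lt ∘ ≤ᵇ-true⇒≤)

<⇒<ᵇ-true : ∀ {m n} → m < n → (m <ᵇ n) ≡ true
<⇒<ᵇ-true lt = T⇒≡true (<⇒<ᵇ lt)

<ᵇ-true⇒< : ∀ {m n} → (m <ᵇ n) ≡ true → m < n
<ᵇ-true⇒< {m} {n} e = <ᵇ⇒< m n (≡true⇒T e)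

≥⇒<ᵇ-false : ∀ {m n} → n ≤ m → (m <ᵇ n) ≡ false
≥⇒<ᵇ-false le = ≢true⇒≡false (λ e → <⇒≱ (<ᵇ-true⇒< e) le)

any-≡ᵇ-true : ∀ {y} L → y ∈ L → any (y ≡ᵇ_) L ≡ true
any-≡ᵇ-true {y} (z ∷ L) (here refl) rewrite ≡ᵇ-refl y = refl
any-≡ᵇ-true {y} (z ∷ L) (there m) with y ≡ᵇ z
... | true = refl
... | false = any-≡ᵇ-true L m

any-≡ᵇ-false : ∀ {y} L → y ∉ L → any (y ≡ᵇ_) L ≡ false
any-≡ᵇ-false L y∉ = ≢true⇒≡false (λ e → y∉ (any-≡ᵇ-true⇒∈ L e))
  where
  any-≡ᵇ-true⇒∈ : ∀ {y} L → any (y ≡ᵇ_) L ≡ true → y ∈ L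
  any-≡ᵇ-true⇒∈ {y} (z ∷ L) e with y ≡ᵇ z in yz
  ... | true = here (≡ᵇ-true⇒≡ yz)
  ... | false = there (any-≡ᵇ-true⇒∈ L e)

all-true⁺ : ∀ (p : ℕ → Bool) L → (∀ {y} → y ∈ L → p y ≡ true) → all p L ≡ true
all-true⁺ p [] f = refl
all-true⁺ p (y ∷ L) f rewrite f (here refl) = all-true⁺ p L (λ m → f (there m))

all-false⁺ : ∀ (p : ℕ → Bool) {y} L → y ∈ L → p y ≡ false → all p L ≡ false
all-false⁺ p (z ∷ L) (here refl) e rewrite e = refl
all-false⁺ p (z ∷ L) (there m) e with p z
... | true = all-false⁺ p L m e
... | false = refl

all-true⁻ : ∀ (p : ℕ → Bool) L → all p L ≡ true → ∀ {y} → y ∈ L → p y ≡ true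
all-true⁻ p (z ∷ L) e (here refl) with p z | e
... | true | _ = refl
all-true⁻ p (z ∷ L) e (there m) with p z | e
... | true | e' = all-true⁻ p L e' m

not-true⇒false : ∀ {a} → not a ≡ true → a ≡ false
not-true⇒false {false} e = refl

false⇒not-true : ∀ {a} → a ≡ false → not a ≡ true
false⇒not-true refl = refl

any-false⁺ : ∀ (p : ℕ → Bool) L → (∀ {z} → z ∈ L → p z ≡ false) → any p L ≡ false
any-false⁺ p [] f = refl
any-false⁺ p (z ∷ L) f rewrite f (here refl) = any-false⁺ p L (λ m → f (there m))

any-true⁺ : ∀ (p : ℕ → Bool) L {z} → z ∈ L → p z ≡ true → any p L ≡ true
any-true⁺ p (z ∷ L) (here refl) e rewrite e = refl
any-true⁺ p (y ∷ L) (there m) e with p y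
... | true = refl
... | false = any-true⁺ p L m e

any-map : ∀ (p : ℕ → Bool) (σ : ℕ → ℕ) L → any p (map σ L) ≡ any (λ z → p (σ z)) L
any-map p σ [] = refl
any-map p σ (z ∷ L) = cong (p (σ z) ∨_) (any-map p σ L)

any-cong : ∀ (p q : ℕ → Bool) L → (∀ {z} → z ∈ L → p z ≡ q z) → any p L ≡ any q L
any-cong p q [] f = refl
any-cong p q (z ∷ L) f = cong₂ _∨_ (f (here refl)) (any-cong p q L (λ m → f (there m)))

distinct⇒unique : ∀ w → distinct w ≡ true → Unique w
distinct⇒unique [] e = []
distinct⇒unique (a ∷ w) e with any (a ≡ᵇ_) w in a∈w | distinct w in dw
... | false | true = All.tabulate (λ m a≡ → a∉w (subst (_∈ w) (sym a≡) m)) ∷ distinct⇒unique w dw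
  where
  a∉w : a ∉ w
  a∉w m with () ← trans (sym (any-≡ᵇ-true w m)) a∈w

unique⇒distinct : ∀ w → Unique w → distinct w ≡ true
unique⇒distinct [] u = refl
unique⇒distinct (a ∷ w) u@(_ ∷ u′) rewrite any-≡ᵇ-false w (head∉tail u) = unique⇒distinct w u′

unique-++⁻ : ∀ {xs ys : List ℕ} → Unique (xs ++ ys) → Unique xs × Unique ys × (∀ {z} → z ∈ xs → z ∉ ys)
unique-++⁻ {[]} u = [] , u , (λ ())
unique-++⁻ {x ∷ xs} {ys} (a ∷ u) =
  let (u1 , u2 , d) = unique-++⁻ {xs} u in
  All.tabulate (λ m → All.lookup a (∈-++⁺ˡ m)) ∷ u1 , u2 ,
  (λ { (here refl) m2 → All.lookup a (∈-++⁺ʳ xs m2) refl ; (there m1) m2 → d m1 m2 })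

∈-range1⁺ : ∀ {n x} → 1 ≤ x → x ≤ n → x ∈ range1 n
∈-range1⁺ {n} {suc x} (s≤s z≤n) x≤n = ∈-map⁺ suc (∈-upTo⁺ x≤n)

∈-range1⁻ : ∀ {n x} → x ∈ range1 n → 1 ≤ x × x ≤ n
∈-range1⁻ m with ∈-map⁻ suc m
... | y , y∈ , refl = s≤s z≤n , ∈-upTo⁻ y∈

range1-unique : ∀ n → Unique (range1 n)
range1-unique n = map⁺-unique suc (upTo n) (Unique.upTo⁺ n) (λ _ _ → suc-injective)

length-range1 : ∀ n → length (range1 n) ≡ n
length-range1 n = trans (length-map suc (upTo n)) (length-upTo n)

IsPerm : ℕ → List ℕ → Set
IsPerm n w = Unique w × length w ≡ n × All (_∈ range1 n) w

∈-words⁺ : ∀ n m w → length w ≡ m → All (_∈ range1 n) w → w ∈ words n m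
∈-words⁺ n zero [] refl [] = here refl
∈-words⁺ n (suc m) (a ∷ w) refl (a∈ ∷ w∈) = ∈-concatMap (range1 n) a∈
  where
  ∈-concatMap : ∀ as → a ∈ as → (a ∷ w) ∈ concatMap (λ b → map (b ∷_) (words n m)) as
  ∈-concatMap (b ∷ as) (here refl) = ∈-++⁺ˡ (∈-map⁺ (a ∷_) (∈-words⁺ n m w refl w∈))
  ∈-concatMap (b ∷ as) (there a∈as) = ∈-++⁺ʳ _ (∈-concatMap as a∈as)

∈-words⁻ : ∀ n m w → w ∈ words n m → length w ≡ m × All (_∈ range1 n) w
∈-words⁻ n zero w (here refl) = refl , []
∈-words⁻ n (suc m) w w∈ = ∈-concatMap (range1 n) w∈ (λ b∈ → b∈)
  where
  ∈-concatMap : ∀ as → w ∈ concatMap (λ b → map (b ∷_) (words n m)) as → (∀ {b} → b ∈ as → b ∈ range1 n) →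
    length w ≡ suc m × All (_∈ range1 n) w
  ∈-concatMap (b ∷ as) w∈ as⊆ with ∈-++⁻ (map (b ∷_) (words n m)) w∈
  ... | inj₂ w∈′ = ∈-concatMap as w∈′ (as⊆ ∘ there)
  ... | inj₁ w∈′ with ∈-map⁻ (b ∷_) w∈′
  ... | v , v∈ , refl = let (len , v⊆) = ∈-words⁻ n m v v∈ in cong suc len , as⊆ (here refl) ∷ v⊆

words-unique : ∀ n m → Unique (words n m)
words-unique n zero = [] ∷ []
words-unique n (suc m) = unique-concatMap (range1 n) (range1-unique n)
  where
  head∈ : ∀ cs {v} → v ∈ concatMap (λ c → map (c ∷_) (words n m)) cs → ∃ λ c → ∃ λ v′ → c ∈ cs × v ≡ c ∷ v′
  head∈ (c ∷ cs) v∈ with ∈-++⁻ (map (c ∷_) (words n m)) v∈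
  ... | inj₁ v∈′ = let (v′ , _ , e) = ∈-map⁻ (c ∷_) v∈′ in c , v′ , here refl , e
  ... | inj₂ v∈′ = let (c′ , v′ , c∈ , e) = head∈ cs v∈′ in c′ , v′ , there c∈ , e
  unique-concatMap : ∀ as → Unique as → Unique (concatMap (λ b → map (b ∷_) (words n m)) as)
  unique-concatMap [] u = []
  unique-concatMap (b ∷ as) (b∉ ∷ u) =
    Unique.++⁺ (map⁺-unique (b ∷_) (words n m) (words-unique n m) (λ _ _ → ∷-injectiveʳ)) (unique-concatMap as u) disjoint
    where
    disjoint : ∀ {v} → ¬ (v ∈ map (b ∷_) (words n m) × v ∈ concatMap (λ c → map (c ∷_) (words n m)) as)
    disjoint (v∈ , v∈′) with ∈-map⁻ (b ∷_) v∈ | head∈ as v∈′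
    ... | _ , _ , refl | c , _ , c∈ , refl = All.lookup b∉ c∈ refl

∈-perms⁻ : ∀ {n w} → w ∈ perms n → IsPerm n w
∈-perms⁻ {n} {w} w∈ = let (w∈words , dw) = ∈-filterᵇ⁻ distinct w∈ ; (len , w⊆) = ∈-words⁻ n n w w∈words in
  distinct⇒unique w dw , len , w⊆

∈-perms⁺ : ∀ {n w} → IsPerm n w → w ∈ perms n
∈-perms⁺ {n} {w} (u , len , w⊆) = ∈-filterᵇ⁺ distinct (∈-words⁺ n n w len w⊆) (unique⇒distinct w u)

perms-unique : ∀ n → Unique (perms n)
perms-unique n = Unique.filter⁺ (T? ∘ distinct) (words-unique n n)

Increasing : List ℕ → Set
Increasing = AllPairs _<_

increasing-≡ : ∀ {xs ys} → Increasing xs → Increasing ys → (∀ {z} → z ∈ xs → z ∈ ys) → (∀ {z} → z ∈ ys → z ∈ xs) → xs ≡ ys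
increasing-≡ [] [] f g = refl
increasing-≡ [] (_∷_ _ _) f g with g (here refl)
... | ()
increasing-≡ (_∷_ _ _) [] f g with f (here refl)
... | ()
increasing-≡ {x ∷ xs} {y ∷ ys} (_∷_ ax ix) (_∷_ ay iy) f g with x ≟ y
... | no ne = ⊥-elim (<-asym (y<x (f (here refl))) (x<y (g (here refl))))
  where
  y<x : x ∈ y ∷ ys → y < x
  y<x (here e) = ⊥-elim (ne e)
  y<x (there m) = All.lookup ay m
  x<y : y ∈ x ∷ xs → x < y
  x<y (here e) = ⊥-elim (ne (sym e))
  x<y (there m) = All.lookup ax m
... | yes refl = cong (x ∷_) (increasing-≡ ix iy xs⊆ys ys⊆xs)
  where
  xs⊆ys : ∀ {z} → z ∈ xs → z ∈ ys
  xs⊆ys m with f (there m)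
  ... | here refl = ⊥-elim (<-irrefl refl (All.lookup ax m))
  ... | there m' = m'
  ys⊆xs : ∀ {z} → z ∈ ys → z ∈ xs
  ys⊆xs m with g (there m)
  ... | here refl = ⊥-elim (<-irrefl refl (All.lookup ay m))
  ... | there m' = m'

range1-increasing : ∀ n → Increasing (range1 n)
range1-increasing n = AllPairs.map⁺ (AllPairs.applyUpTo⁺₁ (λ k → k) n (λ i<j _ → s≤s i<j))

minimum : ∀ (x : ℕ) L → ∃ λ m → m ∈ x ∷ L × (∀ {z} → z ∈ x ∷ L → m ≤ z)
minimum x [] = x , here refl , (λ { (here refl) → ≤-refl })
minimum x (y ∷ L) with minimum y L
... | m , mm , le with x ≤? m
... | yes x≤m = x , here refl , (λ { (here refl) → ≤-refl ; (there mz) → ≤-trans x≤m (le mz) })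
... | no x≰m = m , there mm , (λ { (here refl) → <⇒≤ (≰⇒> x≰m) ; (there mz) → le mz })

applyUpTo-nth : ∀ w → applyUpTo (nth w) (length w) ≡ w
applyUpTo-nth [] = refl
applyUpTo-nth (a ∷ w) = cong (a ∷_) (applyUpTo-nth w)

map-range1 : ∀ (f : ℕ → ℕ) n → map f (range1 n) ≡ applyUpTo (λ k → f (suc k)) n
map-range1 f n = trans (sym (map-∘ (upTo n))) (map-upTo (λ k → f (suc k)) n)

map-app-range1 : ∀ w → map (app w) (range1 (length w)) ≡ w
map-app-range1 w = trans (map-range1 (app w) (length w)) (applyUpTo-nth w)

nth-applyUpTo : ∀ (h : ℕ → ℕ) n k → k < n → nth (applyUpTo h n) k ≡ h k
nth-applyUpTo h (suc n) zero lt = refl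
nth-applyUpTo h (suc n) (suc k) (s≤s lt) = nth-applyUpTo (λ j → h (suc j)) n k lt

app-map-range1 : ∀ (f : ℕ → ℕ) n {x} → x ∈ range1 n → app (map f (range1 n)) x ≡ f x
app-map-range1 f n {x} m with ∈-range1⁻ m
app-map-range1 f n {suc x} m | _ , le rewrite map-range1 f n = nth-applyUpTo (λ k → f (suc k)) n x le

nth-∈ : ∀ w k → k < length w → nth w k ∈ w
nth-∈ (a ∷ w) zero lt = here refl
nth-∈ (a ∷ w) (suc k) (s≤s lt) = there (nth-∈ w k lt)

app-∈-range1 : ∀ n w → IsPerm n w → ∀ {x} → x ∈ range1 n → app w x ∈ range1 n
app-∈-range1 n w (u , refl , r) {x} m with ∈-range1⁻ m
app-∈-range1 n w (u , refl , r) {suc x} m | _ , le = All.lookup r (nth-∈ w x le)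

nth-inj : ∀ w → Unique w → ∀ j k → j < length w → k < length w → nth w j ≡ nth w k → j ≡ k
nth-inj (a ∷ w) u zero zero _ _ e = refl
nth-inj (a ∷ w) u zero (suc k) _ (s≤s lt) e = ⊥-elim (head∉tail u (subst (_∈ w) (sym e) (nth-∈ w k lt)))
nth-inj (a ∷ w) u (suc j) zero (s≤s lt) _ e = ⊥-elim (head∉tail u (subst (_∈ w) e (nth-∈ w j lt)))
nth-inj (a ∷ w) (_ ∷ u) (suc j) (suc k) (s≤s l1) (s≤s l2) e = cong suc (nth-inj w u j k l1 l2 e)

app-injective : ∀ n w → IsPerm n w → ∀ {x y} → x ∈ range1 n → y ∈ range1 n → app w x ≡ app w y → x ≡ y
app-injective n w (u , refl , r) {x} {y} mx my e with ∈-range1⁻ mx | ∈-range1⁻ my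
app-injective n w (u , refl , r) {suc x} {suc y} mx my e | _ , l1 | _ , l2 = cong suc (nth-inj w u x y l1 l2 e)

-- Standard cycle forms

-- Chain π h (a₀ ∷ … ∷ aᵣ): π aᵢ ≡ aᵢ₊₁ and π aᵣ ≡ h, so Chain π h (h ∷ t) says that h ∷ t is a cycle of π.
data Chain (π : ℕ → ℕ) (h : ℕ) : List ℕ → Set where
  end : ∀ {a} → π a ≡ h → Chain π h (a ∷ [])
  link : ∀ {a c r} → π a ≡ c → Chain π h (c ∷ r) → Chain π h (a ∷ c ∷ r)

data Standard : List (List ℕ) → Set where
  std[] : Standard []
  std∷ : ∀ {h t B} → All (h <_) t → All (All (h <_)) B → Standard B → Standard ((h ∷ t) ∷ B)

data CyclesOf (π : ℕ → ℕ) : List (List ℕ) → Set where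
  cyc[] : CyclesOf π []
  cyc∷ : ∀ {h t B} → Chain π h (h ∷ t) → CyclesOf π B → CyclesOf π ((h ∷ t) ∷ B)

Arrangement : ℕ → List ℕ → Set
Arrangement n L = Unique L × (∀ {x} → x ∈ L → x ∈ range1 n) × (∀ {x} → x ∈ range1 n → x ∈ L)

CycleForm : ℕ → List (List ℕ) → Set
CycleForm n B = Arrangement n (concat B) × Standard B

CycleDecomposition : ℕ → (ℕ → ℕ) → List (List ℕ) → Set
CycleDecomposition n π B = CycleForm n B × CyclesOf π B

Nontrivial : List (List ℕ) → Set
Nontrivial B = All (λ b → 2 ≤ length b) B

heads : List (List ℕ) → List ℕ
heads [] = []
heads ([] ∷ B) = heads B
heads ((h ∷ t) ∷ B) = h ∷ heads B

cycles : List ℕ → List (List ℕ)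
cycles w = map (orbit w) (leaders w)

chain-cong : ∀ {π π' h L} → (∀ {y} → y ∈ L → π y ≡ π' y) → Chain π h L → Chain π' h L
chain-cong f (end e) = end (trans (sym (f (here refl))) e)
chain-cong f (link e ch) = link (trans (sym (f (here refl))) e) (chain-cong (λ m → f (there m)) ch)

chain-closed : ∀ {π h a L y} → Chain π h (a ∷ L) → y ∈ a ∷ L → π y ∈ L ⊎ π y ≡ h
chain-closed (end e) (here refl) = inj₂ e
chain-closed (link e ch) (here refl) = inj₁ (here e)
chain-closed (link e ch) (there m) with chain-closed ch m
... | inj₁ m' = inj₁ (there m')
... | inj₂ e' = inj₂ e'

chain-agree : ∀ {π π' h L y} → Chain π h L → Chain π' h L → y ∈ L → π y ≡ π' y
chain-agree (end e) (end e') (here refl) = trans e (sym e')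
chain-agree (link e ch) (link e' ch') (here refl) = trans e (sym e')
chain-agree (link e ch) (link e' ch') (there m) = chain-agree ch ch' m

chain-inj : ∀ {π h a L x y} → Chain π h (a ∷ L) → Unique (a ∷ L) → h ∉ L → x ∈ a ∷ L → y ∈ a ∷ L → π x ≡ π y → x ≡ y
chain-inj ch u nh (here refl) (here refl) e = refl
chain-inj (link e1 ch) u nh (here refl) (there my) e with chain-closed ch my
... | inj₁ m' = ⊥-elim (head∉tail (proj₂ (uniq-tail u)) (subst (_∈ _) (trans (sym e) e1) m'))
  where
  uniq-tail : ∀ {a : ℕ} {L} → Unique (a ∷ L) → a ∉ L × Unique L
  uniq-tail u@(_ ∷ u') = head∉tail u , u'
... | inj₂ e' = ⊥-elim (nh (subst (_∈ _) (sym (trans (sym e') (trans (sym e) e1))) (here refl)))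
chain-inj (link e1 ch) u nh (there mx) (here refl) e with chain-closed ch mx
... | inj₁ m' = ⊥-elim (head∉tail (uniq-tail u) (subst (_∈ _) (trans e e1) m'))
  where
  uniq-tail : ∀ {a : ℕ} {L} → Unique (a ∷ L) → Unique L
  uniq-tail (_ ∷ u') = u'
... | inj₂ e' = ⊥-elim (nh (subst (_∈ _) (sym (trans (sym e') (trans e e1))) (here refl)))
chain-inj (link e1 ch) (_ ∷ u) nh (there mx) (there my) e = chain-inj ch u (λ m → nh (there m)) mx my e

chain-nofix : ∀ {π h L y} → Chain π h L → Unique L → h ∉ L → y ∈ L → π y ≢ y
chain-nofix (end e) u nh (here refl) e' = nh (here (trans (sym e) e'))
chain-nofix (link e ch) u nh (here refl) e' = head∉tail u (here (trans (sym e') e))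
chain-nofix (link e ch) (_ ∷ u) nh (there m) e' = chain-nofix ch u (λ m → nh (there m)) m e'

chain-suffix : ∀ {π h} pre {x post} → Chain π h (pre ++ x ∷ post) → Chain π h (x ∷ post)
chain-suffix [] ch = ch
chain-suffix (a ∷ []) (link e ch) = ch
chain-suffix (a ∷ b ∷ pre) (link e ch) = chain-suffix (b ∷ pre) ch

chain-cycle-closed : ∀ {π h t x} → Chain π h (h ∷ t) → x ∈ h ∷ t → π x ∈ h ∷ t
chain-cycle-closed ch m with chain-closed ch m
... | inj₁ m' = there m'
... | inj₂ e = subst (_∈ _) (sym e) (here refl)

cyclesOf-cong : ∀ {π π' B} → (∀ {y} → y ∈ concat B → π y ≡ π' y) → CyclesOf π B → CyclesOf π' B
cyclesOf-cong f cyc[] = cyc[]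
cyclesOf-cong {B = (h ∷ t) ∷ B} f (cyc∷ ch cy) = cyc∷ (chain-cong (λ m → f (∈-++⁺ˡ m)) ch) (cyclesOf-cong (λ m → f (∈-++⁺ʳ (h ∷ t) m)) cy)

cyclesOf-closed : ∀ {π B x} → CyclesOf π B → x ∈ concat B → π x ∈ concat B
cyclesOf-closed {B = (h ∷ t) ∷ B} (cyc∷ ch cy) m with ∈-++⁻ (h ∷ t) m
... | inj₂ m' = ∈-++⁺ʳ (h ∷ t) (cyclesOf-closed cy m')
... | inj₁ m' with chain-closed ch m'
... | inj₁ m'' = there (∈-++⁺ˡ m'')
... | inj₂ e = subst (_∈ _) (sym e) (here refl)

cyclesOf-injective : ∀ {π B x y} → CyclesOf π B → Unique (concat B) → x ∈ concat B → y ∈ concat B → π x ≡ π y → x ≡ y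
cyclesOf-injective {B = (h ∷ t) ∷ B} (cyc∷ ch cy) u mx my e with unique-++⁻ {h ∷ t} u
... | u1 , u2 , d with ∈-++⁻ (h ∷ t) mx | ∈-++⁻ (h ∷ t) my
... | inj₁ a | inj₁ b = chain-inj ch u1 (head∉tail u1) a b e
... | inj₂ a | inj₂ b = cyclesOf-injective cy u2 a b e
... | inj₁ a | inj₂ b = ⊥-elim (d (chain-cycle-closed ch a) (subst (_∈ _) (sym e) (cyclesOf-closed cy b)))
... | inj₂ a | inj₁ b = ⊥-elim (d (chain-cycle-closed ch b) (subst (_∈ _) e (cyclesOf-closed cy a)))

cyclesOf-agree : ∀ {π π' B x} → CyclesOf π B → CyclesOf π' B → x ∈ concat B → π x ≡ π' x
cyclesOf-agree {B = (h ∷ t) ∷ B} (cyc∷ ch cy) (cyc∷ ch' cy') m with ∈-++⁻ (h ∷ t) m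
... | inj₁ a = chain-agree ch ch' a
... | inj₂ a = cyclesOf-agree cy cy' a

nontrivial⇒fixedPointFree : ∀ {π B x} → CyclesOf π B → Unique (concat B) → Nontrivial B → x ∈ concat B → π x ≢ x
nontrivial⇒fixedPointFree {B = (h ∷ []) ∷ B} (cyc∷ ch cy) u (s≤s () ∷ _) m
nontrivial⇒fixedPointFree {B = (h ∷ c ∷ r) ∷ B} (cyc∷ (link e ch) cy) u (_ ∷ d) m with unique-++⁻ {h ∷ c ∷ r} u
... | u1@(_ ∷ u1') , u2 , dj with ∈-++⁻ (h ∷ c ∷ r) m
... | inj₁ (here refl) = λ e' → head∉tail u1 (here (trans (sym e') e))
... | inj₁ (there a) = chain-nofix ch u1' (head∉tail u1) a
... | inj₂ a = nontrivial⇒fixedPointFree cy u2 d a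

fixedPointFree⇒nontrivial : ∀ {π B} → CyclesOf π B → (∀ {x} → x ∈ concat B → π x ≢ x) → Nontrivial B
fixedPointFree⇒nontrivial cyc[] f = []
fixedPointFree⇒nontrivial {B = (h ∷ []) ∷ B} (cyc∷ (end e) cy) f = ⊥-elim (f (here refl) e)
fixedPointFree⇒nontrivial {B = (h ∷ c ∷ r) ∷ B} (cyc∷ ch cy) f = s≤s (s≤s z≤n) ∷ fixedPointFree⇒nontrivial cy (λ m → f (∈-++⁺ʳ (h ∷ c ∷ r) m))

walk : ℕ → (ℕ → ℕ) → ℕ → ℕ → List ℕ
walk i π zero _ = []
walk i π (suc f) j = if j ≡ᵇ i then [] else j ∷ walk i π f (π j)

-- orbit iterates a local function that cannot be named; walk-unique identifies it with the top-level walk.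
walk-unique : ∀ (i : ℕ) (π : ℕ → ℕ) (G : ℕ → ℕ → List ℕ) → (∀ j → G 0 j ≡ []) →
  (∀ f j → G (suc f) j ≡ (if j ≡ᵇ i then [] else j ∷ G f (π j))) → ∀ f j → G f j ≡ walk i π f j
walk-unique i π G z s zero j = z j
walk-unique i π G z s (suc f) j rewrite s f j with j ≡ᵇ i
... | true = refl
... | false = cong (j ∷_) (walk-unique i π G z s f (π j))

orbit≡walk : ∀ w i → orbit w i ≡ i ∷ walk i (app w) (length w) (app w i)
orbit≡walk w i with length w | app w i | walk-unique i (app w) _ (λ j → refl) (λ f j → refl)
... | f | j | H = cong (i ∷_) (H f j)

walk-self : ∀ i π f → walk i π f i ≡ []
walk-self i π zero = refl
walk-self i π (suc f) rewrite ≡ᵇ-refl i = refl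

walk-chain : ∀ {π x a L} f → Chain π x (a ∷ L) → x ∉ (a ∷ L) → length (a ∷ L) ≤ f → walk x π f a ≡ a ∷ L
walk-chain {π} {x} {a} (suc f) (end e) nx (s≤s le) rewrite ≢⇒≡ᵇ-false {a} {x} (λ eq → nx (here (sym eq))) | e = cong (a ∷_) (walk-self x π f)
walk-chain {π} {x} {a} (suc f) (link {c = c} {r = r} e ch) nx (s≤s le) rewrite ≢⇒≡ᵇ-false {a} {x} (λ eq → nx (here (sym eq))) | e =
  cong (a ∷_) (walk-chain f ch (λ m → nx (there m)) le)

walk-cycle : ∀ {π h t} f → Chain π h (h ∷ t) → h ∉ t → length t ≤ f → h ∷ walk h π f (π h) ≡ h ∷ t
walk-cycle {π} {h} {[]} f (end e) nh le rewrite e = cong (h ∷_) (walk-self h π f)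
walk-cycle {π} {h} {c ∷ r} f (link e ch) nh le rewrite e = cong (h ∷_) (walk-chain f ch nh le)

∈-walk-self : ∀ {π h x} f → h ≢ x → 1 ≤ f → h ∈ walk x π f h
∈-walk-self (suc f) hx _ rewrite ≢⇒≡ᵇ-false hx = here refl

∈-walk : ∀ {π h x a L} f → Chain π h (a ∷ L) → x ∉ (a ∷ L) → h ≢ x → suc (length (a ∷ L)) ≤ f → h ∈ walk x π f a
∈-walk {π} {h} {x} {a} (suc f) (end e) nx hx (s≤s le) rewrite ≢⇒≡ᵇ-false {a} {x} (λ eq → nx (here (sym eq))) | e = there (∈-walk-self f hx le)
∈-walk {π} {h} {x} {a} (suc f) (link e ch) nx hx (s≤s le) rewrite ≢⇒≡ᵇ-false {a} {x} (λ eq → nx (here (sym eq))) | e =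
  there (∈-walk f ch (λ m → nx (there m)) hx le)

heads⊆concat : ∀ B {x} → x ∈ heads B → x ∈ concat B
heads⊆concat ([] ∷ B) m = ∈-++⁺ʳ [] (heads⊆concat B m)
heads⊆concat ((h ∷ t) ∷ B) (here refl) = here refl
heads⊆concat ((h ∷ t) ∷ B) (there m) = ∈-++⁺ʳ (h ∷ t) (heads⊆concat B m)

All-heads : ∀ {P : ℕ → Set} B → All (All P) B → All P (heads B)
All-heads [] [] = []
All-heads ([] ∷ B) (_ ∷ a) = All-heads B a
All-heads ((h ∷ t) ∷ B) ((p ∷ _) ∷ a) = p ∷ All-heads B a

heads-increasing : ∀ {B} → Standard B → Increasing (heads B)
heads-increasing std[] = []
heads-increasing {(h ∷ t) ∷ B} (std∷ _ a hm) = _∷_ (All-heads B a) (heads-increasing hm)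

module Leaders (w : List ℕ) where
  n = length w
  π = app w

  orbit-of-head : ∀ {h t} → Chain π h (h ∷ t) → Unique (h ∷ t) → (∀ {x} → x ∈ h ∷ t → x ∈ range1 n) → orbit w h ≡ h ∷ t
  orbit-of-head {h} {t} ch u sub = trans (orbit≡walk w h) (walk-cycle n ch (head∉tail u) le)
    where
    le : length t ≤ n
    le = ≤-trans (n≤1+n _) (subst (suc (length t) ≤_) (length-range1 n) (⊆⇒length-≤ (h ∷ t) (range1 n) u sub))

  map-orbit-heads : ∀ B → CyclesOf π B → Unique (concat B) → (∀ {x} → x ∈ concat B → x ∈ range1 n) → map (orbit w) (heads B) ≡ B
  map-orbit-heads [] cyc[] u sub = refl
  map-orbit-heads ((h ∷ t) ∷ B) (cyc∷ ch cy) u sub =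
    let (u1 , u2 , d) = unique-++⁻ {h ∷ t} u in
    cong₂ _∷_ (orbit-of-head ch u1 (λ m → sub (∈-++⁺ˡ m))) (map-orbit-heads B cy u2 (λ m → sub (∈-++⁺ʳ (h ∷ t) m)))

  isLeader-head : ∀ {h t} → Chain π h (h ∷ t) → Unique (h ∷ t) → (∀ {x} → x ∈ h ∷ t → x ∈ range1 n) → All (h <_) t → isLeader w h ≡ true
  isLeader-head {h} {t} ch u sub a = trans (cong (all (h ≤ᵇ_)) (orbit-of-head ch u sub)) (
    all-true⁺ (h ≤ᵇ_) (h ∷ t) (λ { (here refl) → ≤⇒≤ᵇ-true (≤-refl {h}) ; (there m) → ≤⇒≤ᵇ-true (<⇒≤ (All.lookup a m)) }))

  head∈walk : ∀ {h x} post → Chain π h (x ∷ post) → Unique (x ∷ post) → 2 + length post ≤ n → h < x → h ∈ walk x π n (π x)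
  head∈walk [] (end e) u lp hx rewrite e = ∈-walk-self n (λ eq → <-irrefl eq hx) (≤-trans (s≤s z≤n) lp)
  head∈walk (c ∷ r) (link e chh) u lp hx rewrite e = ∈-walk n chh (head∉tail u) (λ eq → <-irrefl eq hx) (≤-trans (n≤1+n _) lp)

  isLeader-tail : ∀ {h t x} → Chain π h (h ∷ t) → Unique (h ∷ t) → (∀ {y} → y ∈ h ∷ t → y ∈ range1 n) → All (h <_) t → x ∈ t → isLeader w x ≡ false
  isLeader-tail {h} {t} {x} ch u sub a mx with ∈-∃++ mx
  ... | pre , post , refl = trans (cong (all (x ≤ᵇ_)) (orbit≡walk w x)) (all-false⁺ (x ≤ᵇ_) (x ∷ walk x π n (π x)) (there hin) (>⇒≤ᵇ-false hx))
    where
    hx : h < x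
    hx = All.lookup a mx
    u' : Unique (x ∷ post)
    u' = proj₁ (proj₂ (unique-++⁻ {h ∷ pre} u))
    lenle : length (h ∷ pre ++ x ∷ post) ≤ n
    lenle = subst (length (h ∷ pre ++ x ∷ post) ≤_) (length-range1 n) (⊆⇒length-≤ _ (range1 n) u sub)
    lenpost : 2 + length post ≤ n
    lenpost = ≤-trans (s≤s (subst (suc (length post) ≤_) (sym (length-++ pre {x ∷ post})) (m≤n+m _ (length pre)))) lenle
    hin : h ∈ walk x π n (π x)
    hin = head∈walk post (chain-suffix (h ∷ pre) ch) u' lenpost hx

  leader-dichotomy : ∀ B → CyclesOf π B → Standard B → Unique (concat B) → (∀ {x} → x ∈ concat B → x ∈ range1 n) →
    ∀ {x} → x ∈ concat B → (x ∈ heads B × isLeader w x ≡ true) ⊎ (x ∉ heads B × isLeader w x ≡ false)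
  leader-dichotomy ((h ∷ t) ∷ B) (cyc∷ ch cy) (std∷ a aa hm) u sub {x} mx with unique-++⁻ {h ∷ t} u
  ... | u1 , u2 , d with ∈-++⁻ (h ∷ t) mx
  ... | inj₁ (here refl) = inj₁ (here refl , isLeader-head ch u1 (λ m → sub (∈-++⁺ˡ m)) a)
  ... | inj₁ (there m) = inj₂ (nh , isLeader-tail ch u1 (λ m → sub (∈-++⁺ˡ m)) a m)
    where
    nh : x ∉ h ∷ heads B
    nh (here refl) = head∉tail u1 m
    nh (there m') = d (there m) (heads⊆concat B m')
  ... | inj₂ m with leader-dichotomy B cy hm u2 (λ m → sub (∈-++⁺ʳ (h ∷ t) m)) m
  ... | inj₁ (mh , l) = inj₁ (there mh , l)
  ... | inj₂ (nh , l) = inj₂ (nh' , l)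
    where
    nh' : x ∉ h ∷ heads B
    nh' (here refl) = d (here refl) m
    nh' (there m') = nh m'

  leaders≡heads : ∀ B → CycleDecomposition n π B → leaders w ≡ heads B
  leaders≡heads B (((u , sub , cov) , hm) , cy) = increasing-≡ (AllPairs.filter⁺ (T? ∘ isLeader w) (range1-increasing n)) (heads-increasing hm) f g
    where
    f : ∀ {z} → z ∈ leaders w → z ∈ heads B
    f m with ∈-filterᵇ⁻ (isLeader w) m
    ... | mr , l with leader-dichotomy B cy hm u sub (cov mr)
    ... | inj₁ (mh , _) = mh
    ... | inj₂ (_ , l') with () ← trans (sym l) l'
    g : ∀ {z} → z ∈ heads B → z ∈ leaders w
    g m with leader-dichotomy B cy hm u sub (heads⊆concat B m)
    ... | inj₁ (_ , l) = ∈-filterᵇ⁺ (isLeader w) (sub (heads⊆concat B m)) l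
    ... | inj₂ (nh , _) = ⊥-elim (nh m)

cycles-unique : ∀ w B → CycleDecomposition (length w) (app w) B → cycles w ≡ B
cycles-unique w B v@(((u , sub , cov) , hm) , cy) =
  trans (cong (map (orbit w)) (Leaders.leaders≡heads w B v)) (Leaders.map-orbit-heads w B cy u sub)

iter : (ℕ → ℕ) → ℕ → ℕ → ℕ
iter π zero y = y
iter π (suc k) y = iter π k (π y)

iter-comm : ∀ π k y → π (iter π k y) ≡ iter π k (π y)
iter-comm π zero y = refl
iter-comm π (suc k) y = iter-comm π k (π y)

iter-+ : ∀ π a b y → iter π (a + b) y ≡ iter π b (iter π a y)
iter-+ π zero b y = refl
iter-+ π (suc a) b y = iter-+ π a b (π y)

iterates : (ℕ → ℕ) → ℕ → ℕ → List ℕ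
iterates π y q = applyUpTo (λ k → iter π k y) q

iterates-chain : ∀ π x q y → π (iter π q y) ≡ x → Chain π x (iterates π y (suc q))
iterates-chain π x zero y e = end e
iterates-chain π x (suc q) y e = link refl (iterates-chain π x q (π y) e)

module Orbits (n : ℕ) (w : List ℕ) (perm : IsPerm n w) where
  π = app w

  iter-∈-range1 : ∀ k {y} → y ∈ range1 n → iter π k y ∈ range1 n
  iter-∈-range1 zero m = m
  iter-∈-range1 (suc k) m = iter-∈-range1 k (app-∈-range1 n w perm m)

  iter-cancel : ∀ a b {x} → x ∈ range1 n → iter π (suc a) x ≡ iter π (suc b) x → iter π a x ≡ iter π b x
  iter-cancel a b {x} m e = app-injective n w perm (iter-∈-range1 a m) (iter-∈-range1 b m)
    (trans (iter-comm π a x) (trans e (sym (iter-comm π b x))))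

  iter-cancel-prefix : ∀ a b {x} → x ∈ range1 n → iter π a x ≡ iter π (a + b) x → x ≡ iter π b x
  iter-cancel-prefix zero b m e = e
  iter-cancel-prefix (suc a) b m e = iter-cancel-prefix a b m (iter-cancel a (a + b) m e)

  DistinctUpTo : ℕ → ℕ → Set
  DistinctUpTo x m = ∀ a b → a < b → b ≤ m → iter π a x ≢ iter π b x

  ReturnsWithin : ℕ → ℕ → Set
  ReturnsWithin x m = ∃ λ q → suc q ≤ m × iter π (suc q) x ≡ x × (∀ s → 0 < s → s < suc q → iter π s x ≢ x)

  returnsOrDistinct : ∀ {x} → x ∈ range1 n → ∀ m → ReturnsWithin x m ⊎ DistinctUpTo x m
  returnsOrDistinct mx zero = inj₂ (λ a b lt le → ⊥-elim (<⇒≱ lt (≤-trans le z≤n)))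
  returnsOrDistinct {x} mx (suc m) with returnsOrDistinct mx m
  ... | inj₁ (q , le , e , mn) = inj₁ (q , ≤-trans le (n≤1+n m) , e , mn)
  ... | inj₂ d with iter π (suc m) x ≟ x
  ... | yes e = inj₁ (m , ≤-refl , e , (λ s pos lt e' → d 0 s pos (≤-pred lt) (sym e')))
  ... | no ne = inj₂ d'
    where
    d' : DistinctUpTo x (suc m)
    d' a b lt le with m≤n⇒m<n∨m≡n le
    ... | inj₁ (s≤s b≤m) = d a b lt b≤m
    ... | inj₂ refl with a
    ... | zero = λ e → ne (sym e)
    ... | suc a' = λ e → d a' m (≤-pred lt) ≤-refl (iter-cancel a' m mx e)

  firstReturn : ∀ {x} → x ∈ range1 n → ReturnsWithin x n
  firstReturn {x} mx with returnsOrDistinct mx n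
  ... | inj₁ f = f
  ... | inj₂ d = ⊥-elim (<-irrefl refl (subst (_≤ n) (length-applyUpTo (λ k → iter π k x) (suc n))
          (subst (length (iterates π x (suc n)) ≤_) (length-range1 n)
            (⊆⇒length-≤ (iterates π x (suc n)) (range1 n) uq sb))))
    where
    uq : Unique (iterates π x (suc n))
    uq = Unique.applyUpTo⁺₁ (λ k → iter π k x) (suc n) (λ lt lt' → d _ _ lt (≤-pred lt'))
    sb : ∀ {y} → y ∈ iterates π x (suc n) → y ∈ range1 n
    sb m with ∈-applyUpTo⁻ (λ k → iter π k x) m
    ... | k , _ , refl = iter-∈-range1 k mx

  orbit≡iterates : ∀ {x} (mx : x ∈ range1 n) → orbit w x ≡ iterates π x (suc (proj₁ (firstReturn mx)))
  orbit≡iterates {x} mx with firstReturn mx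
  ... | q , le , e , mn = trans (orbit≡walk w x) (walk-cycle {π} {x} {iterates π (π x) q} (length w) ch nx lq)
    where
    ch : Chain π x (x ∷ iterates π (π x) q)
    ch = iterates-chain π x q x (trans (iter-comm π q x) e)
    nx : x ∉ iterates π (π x) q
    nx m with ∈-applyUpTo⁻ (λ k → iter π k (π x)) m
    ... | k , lt , eq = mn (suc k) (s≤s z≤n) (s≤s lt) (sym eq)
    lq : length (iterates π (π x) q) ≤ length w
    lq = subst₂ _≤_ (sym (length-applyUpTo _ q)) (sym (proj₁ (proj₂ perm))) (≤-trans (n≤1+n q) le)

  Reach : ℕ → ℕ → Set
  Reach x y = ∃ λ k → y ≡ iter π k x

  ∈-orbit⁻ : ∀ {x y} (mx : x ∈ range1 n) → y ∈ orbit w x → Reach x y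
  ∈-orbit⁻ {x} {y} mx m with ∈-applyUpTo⁻ (λ k → iter π k x) (subst (y ∈_) (orbit≡iterates mx) m)
  ... | k , _ , e = k , e

  ∈-orbit⁺ : ∀ {x y} (mx : x ∈ range1 n) → Reach x y → y ∈ orbit w x
  ∈-orbit⁺ {x} mx (k , refl) = subst (iter π k x ∈_) (sym (orbit≡iterates mx)) (go k)
    where
    q = proj₁ (firstReturn mx)
    ex : iter π (suc q) x ≡ x
    ex = proj₁ (proj₂ (proj₂ (firstReturn mx)))
    go : ∀ k → iter π k x ∈ iterates π x (suc q)
    go k = subst (_∈ iterates π x (suc q)) (sym (red k)) (∈-applyUpTo⁺ (λ j → iter π j x) (m%n<n k (suc q)))
      where
      per : ∀ t j → iter π (j + t * suc q) x ≡ iter π j x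
      per zero j = cong (λ z → iter π z x) (+-identityʳ j)
      per (suc t) j = trans (cong (λ z → iter π z x) (trans (cong (λ z → j + z) (+-comm (suc q) (t * suc q))) (sym (+-assoc j (t * suc q) (suc q)))))
                     (trans (iter-+ π (j + t * suc q) (suc q) x) (trans (cong (iter π (suc q)) (per t j)) (trans (sym (iter-+ π j (suc q) x)) (trans (cong (λ z → iter π z x) (+-comm j (suc q))) (trans (iter-+ π (suc q) j x) (cong (iter π j) ex))))))
      red : ∀ k → iter π k x ≡ iter π (k % suc q) x
      red k = trans (cong (λ z → iter π z x) (m≡m%n+[m/n]*n k (suc q))) (per (k / suc q) (k % suc q))

  reach-trans : ∀ {x y z} → Reach x y → Reach y z → Reach x z
  reach-trans {x} (a , refl) (b , refl) = a + b , sym (iter-+ π a b x)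

  reach-sym : ∀ {x y} → x ∈ range1 n → Reach x y → Reach y x
  reach-sym {x} mx (k , refl) with firstReturn mx
  ... | q , le , e , mn = (k * q) , sym (trans (sym (iter-+ π k (k * q) x)) (per k))
    where
    per : ∀ k → iter π (k + k * q) x ≡ x
    per zero = refl
    per (suc k) = trans (cong (λ z → iter π z x) (reassociate k)) (trans (iter-+ π (suc q) (k + k * q) x) (trans (cong (iter π (k + k * q)) e) (per k)))
      where
      reassociate : ∀ k → suc k + suc k * q ≡ suc q + (k + k * q)
      reassociate k = cong suc (trans (cong (λ z → k + z) (+-comm q (k * q))) (trans (sym (+-assoc k (k * q) q)) (+-comm (k + k * q) q)))

  reach-rng : ∀ {x y} → x ∈ range1 n → Reach x y → y ∈ range1 n
  reach-rng mx (k , refl) = iter-∈-range1 k mx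

  orbit-unique : ∀ {x} (mx : x ∈ range1 n) → Unique (orbit w x)
  orbit-unique {x} mx with firstReturn mx | orbit≡iterates mx
  ... | q , le , e , mn | eq = subst Unique (sym eq) (Unique.applyUpTo⁺₁ (λ k → iter π k x) (suc q) nd)
    where
    nd : ∀ {a b} → a < b → b < suc q → iter π a x ≢ iter π b x
    nd {a} {b} lt lt' e' with m≤n⇒∃[o]m+o≡n (<⇒≤ lt)
    ... | d , refl = mn d (+-cancelˡ-< a 0 d (subst (_< a + d) (sym (+-identityʳ a)) lt)) (≤-trans (s≤s (m≤n+m d a)) lt') (sym (iter-cancel-prefix a d mx e'))

  leader-≤ : ∀ {l y} → isLeader w l ≡ true → y ∈ orbit w l → l ≤ y
  leader-≤ {l} e m = ≤ᵇ-true⇒≤ (all-true⁻ (l ≤ᵇ_) (orbit w l) e m)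

  ∈-leaders⁻ : ∀ {l} → l ∈ leaders w → l ∈ range1 n × isLeader w l ≡ true
  ∈-leaders⁻ m with ∈-filterᵇ⁻ (isLeader w) m
  ... | a , b = subst (λ k → _ ∈ range1 k) (proj₁ (proj₂ perm)) a , b

  orbit-chain : ∀ {x} (mx : x ∈ range1 n) → Chain π x (orbit w x)
  orbit-chain {x} mx with firstReturn mx | orbit≡iterates mx
  ... | q , le , e , mn | eq = subst (Chain π x) (sym eq) (iterates-chain π x q x (trans (iter-comm π q x) e))

  orbits-disjoint : ∀ {l l' y} → l ∈ leaders w → l' ∈ leaders w → y ∈ orbit w l → y ∈ orbit w l' → l ≡ l'
  orbits-disjoint ml ml' m m' with ∈-leaders⁻ ml | ∈-leaders⁻ ml'
  ... | r , i | r' , i' =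
    let ry = ∈-orbit⁻ r m ; ry' = ∈-orbit⁻ r' m' ; yr = reach-rng r ry
        a = leader-≤ i (∈-orbit⁺ r (reach-trans ry (reach-sym r' ry')))
        b = leader-≤ i' (∈-orbit⁺ r' (reach-trans ry' (reach-sym r ry)))
    in ≤-antisym a b

  cycles-unique-concat : ∀ L → Unique L → (∀ {l} → l ∈ L → l ∈ leaders w) → Unique (concat (map (orbit w) L))
  cycles-unique-concat [] u f = []
  cycles-unique-concat (l ∷ L) (a ∷ u) f = Unique.++⁺ (orbit-unique (proj₁ (∈-leaders⁻ (f (here refl))))) (cycles-unique-concat L u (λ m → f (there m))) dj
    where
    dj : ∀ {v} → ¬ (v ∈ orbit w l × v ∈ concat (map (orbit w) L))
    dj (m1 , m2) with find (∈-concatMap⁻ (orbit w) m2)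
    ... | l' , ml' , m3 = All.lookup a ml' (orbits-disjoint (f (here refl)) (f (there ml')) m1 m3)

  cycles-standard : ∀ L → Increasing L → (∀ {l} → l ∈ L → l ∈ leaders w) → Standard (map (orbit w) L)
  cycles-standard [] i f = std[]
  cycles-standard (l ∷ L) (_∷_ a i) f with ∈-leaders⁻ (f (here refl))
  ... | r , il = std∷ (All.tabulate (λ m → ≤∧≢⇒< (leader-≤ il (there m)) (λ e → head∉tail (orbit-unique r) (subst (_∈ _) (sym e) m)))) (All.tabulate above) (cycles-standard L i (λ m → f (there m)))
    where
    above : ∀ {b} → b ∈ map (orbit w) L → All (l <_) b
    above m with ∈-map⁻ (orbit w) m
    ... | l' , ml' , refl with ∈-leaders⁻ (f (there ml'))
    ... | r' , il' = All.tabulate (λ my → <-≤-trans (All.lookup a ml') (leader-≤ il' my))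

  cycles-cyclesOf : ∀ L → (∀ {l} → l ∈ L → l ∈ leaders w) → CyclesOf π (map (orbit w) L)
  cycles-cyclesOf [] f = cyc[]
  cycles-cyclesOf (l ∷ L) f = cyc∷ (orbit-chain (proj₁ (∈-leaders⁻ (f (here refl))))) (cycles-cyclesOf L (λ m → f (there m)))

  cycles-decomposition : CycleDecomposition n π (cycles w)
  cycles-decomposition = ((cycles-unique-concat (leaders w) uL (λ m → m) , sub , cov) , cycles-standard (leaders w) iL (λ m → m)) , cycles-cyclesOf (leaders w) (λ m → m)
    where
    uL : Unique (leaders w)
    uL = Unique.filter⁺ (T? ∘ isLeader w) (range1-unique (length w))
    iL : Increasing (leaders w)
    iL = AllPairs.filter⁺ (T? ∘ isLeader w) (range1-increasing (length w))
    sub : ∀ {x} → x ∈ concat (cycles w) → x ∈ range1 n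
    sub m with find (∈-concatMap⁻ (orbit w) m)
    ... | l , ml , my = let r = proj₁ (∈-leaders⁻ ml) in reach-rng r (∈-orbit⁻ r my)
    cov : ∀ {x} → x ∈ range1 n → x ∈ concat (cycles w)
    cov {x} mx with minimum x (walk x π (length w) (π x))
    ... | m , mm , le = ∈-concatMap⁺ (orbit w) (lose mlead (∈-orbit⁺ rm (reach-sym mx rxm)))
      where
      rxm : Reach x m
      rxm = ∈-orbit⁻ mx (subst (m ∈_) (sym (orbit≡walk w x)) mm)
      rm : m ∈ range1 n
      rm = reach-rng mx rxm
      il : isLeader w m ≡ true
      il = all-true⁺ (m ≤ᵇ_) (orbit w m) (λ {z} mz → ≤⇒≤ᵇ-true (le (subst (z ∈_) (orbit≡walk w x) (∈-orbit⁺ mx (reach-trans rxm (∈-orbit⁻ rm mz))))))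
      mlead : m ∈ leaders w
      mlead = ∈-filterᵇ⁺ (isLeader w) (subst (λ k → m ∈ range1 k) (sym (proj₁ (proj₂ perm))) rm) il

cycles-valid : ∀ n w → w ∈ perms n → CycleDecomposition n (app w) (cycles w)
cycles-valid n w m = Orbits.cycles-decomposition n w (∈-perms⁻ {n} {w} m)

nextInCycle : ℕ → List ℕ → ℕ → ℕ
nextInCycle h [] y = 0
nextInCycle h (a ∷ []) y = h
nextInCycle h (a ∷ c ∷ r) y = if a ≡ᵇ y then c else nextInCycle h (c ∷ r) y

successorIn : List (List ℕ) → ℕ → ℕ
successorIn [] y = 0
successorIn ([] ∷ B) y = successorIn B y
successorIn ((h ∷ t) ∷ B) y = if any (y ≡ᵇ_) (h ∷ t) then nextInCycle h (h ∷ t) y else successorIn B y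

fromCycles : ℕ → List (List ℕ) → List ℕ
fromCycles n B = map (successorIn B) (range1 n)

nextInCycle-chain : ∀ h a L → Unique (a ∷ L) → Chain (nextInCycle h (a ∷ L)) h (a ∷ L)
nextInCycle-chain h a [] u = end refl
nextInCycle-chain h a (c ∷ r) u@(_ ∷ u') =
  link nx (chain-cong (λ {y} m → sym (eqn y m)) (nextInCycle-chain h c r u'))
  where
  nx : nextInCycle h (a ∷ c ∷ r) a ≡ c
  nx rewrite ≡ᵇ-refl a = refl
  eqn : ∀ y → y ∈ c ∷ r → nextInCycle h (a ∷ c ∷ r) y ≡ nextInCycle h (c ∷ r) y
  eqn y m rewrite ≢⇒≡ᵇ-false {a} {y} (λ e → head∉tail u (subst (_∈ _) (sym e) m)) = refl

successorIn-cycles : ∀ B → Unique (concat B) → Standard B → CyclesOf (successorIn B) B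
successorIn-cycles [] u std[] = cyc[]
successorIn-cycles ((h ∷ t) ∷ B) u (std∷ _ _ hm) with unique-++⁻ {h ∷ t} u
... | u1 , u2 , d = cyc∷ (chain-cong (λ {y} m → sym (e1 y m)) (nextInCycle-chain h h t u1))
                        (cyclesOf-cong (λ {y} m → sym (e2 y m)) (successorIn-cycles B u2 hm))
  where
  e1 : ∀ y → y ∈ h ∷ t → successorIn ((h ∷ t) ∷ B) y ≡ nextInCycle h (h ∷ t) y
  e1 y m rewrite any-≡ᵇ-true (h ∷ t) m = refl
  e2 : ∀ y → y ∈ concat B → successorIn ((h ∷ t) ∷ B) y ≡ successorIn B y
  e2 y m rewrite any-≡ᵇ-false (h ∷ t) (λ m' → d m' m) = refl

fromCycles-decomposition : ∀ n B → CycleForm n B → IsPerm n (fromCycles n B) × CyclesOf (app (fromCycles n B)) B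
fromCycles-decomposition n B ((u , sub , cov) , hm) = (uniq , len , All.tabulate rng) , cyc
  where
  cy = successorIn-cycles B u hm
  cyc : CyclesOf (app (fromCycles n B)) B
  cyc = cyclesOf-cong (λ m → sym (app-map-range1 (successorIn B) n (sub m))) cy
  uniq : Unique (fromCycles n B)
  uniq = map⁺-unique (successorIn B) (range1 n) (range1-unique n) (λ mx my e → cyclesOf-injective cy u (cov mx) (cov my) e)
  len : length (fromCycles n B) ≡ n
  len = trans (length-map (successorIn B) (range1 n)) (length-range1 n)
  rng : ∀ {z} → z ∈ fromCycles n B → z ∈ range1 n
  rng m with ∈-map⁻ (successorIn B) m
  ... | x , mx , refl = sub (cyclesOf-closed cy (cov mx))

cycles-determine-perm : ∀ n w w' B → IsPerm n w → IsPerm n w' → CyclesOf (app w) B → CyclesOf (app w') B → (∀ {x} → x ∈ range1 n → x ∈ concat B) → w ≡ w'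
cycles-determine-perm n w w' B (u , refl , r) (u' , l' , r') c c' cov =
  trans (sym (map-app-range1 w)) (trans (map-cong-local (All.tabulate (λ m → cyclesOf-agree c c' (cov m))))
    (trans (cong (λ k → map (app w') (range1 k)) (sym l')) (map-app-range1 w')))

fromCycles-∈-perms : ∀ n B → CycleForm n B → fromCycles n B ∈ perms n
fromCycles-∈-perms n B v = ∈-perms⁺ (proj₁ (fromCycles-decomposition n B v))

cycles-fromCycles : ∀ n B → CycleForm n B → cycles (fromCycles n B) ≡ B
cycles-fromCycles n B v with fromCycles-decomposition n B v
... | (u , l , r) , cy = cycles-unique (fromCycles n B) B (subst (λ k → CycleDecomposition k (app (fromCycles n B)) B) (sym l) (v , cy))

fromCycles-cycles : ∀ n w → w ∈ perms n → fromCycles n (cycles w) ≡ w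
fromCycles-cycles n w m =
  let (form@((_ , _ , cov) , _) , cy) = cycles-valid n w m ; (perm′ , cy′) = fromCycles-decomposition n (cycles w) form in
  cycles-determine-perm n (fromCycles n (cycles w)) w (cycles w) perm′ (∈-perms⁻ m) cy′ cy cov

Transfer : ℕ → ℕ → (R S : List (List ℕ) → Bool) (f g : List (List ℕ) → List (List ℕ)) → Set
Transfer m m′ R S f g = ∀ B → CycleForm m B → R B ≡ true → CycleForm m′ (f B) × S (f B) ≡ true × g (f B) ≡ B

count-byCycles : ∀ n n′ (P Q : List (List ℕ) → Bool) (del ins : List (List ℕ) → List (List ℕ)) →
  Transfer n n′ P Q del ins → Transfer n′ n Q P ins del →
  count (P ∘ cycles) (perms n) ≡ count (Q ∘ cycles) (perms n′)
count-byCycles n n′ P Q del ins fwd bwd =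
  count-≡-byBijection (P ∘ cycles) (Q ∘ cycles) (perms n) (perms n′) (perms-unique n) (perms-unique n′)
    (onPerms n′ del) (onPerms n ins) (onPerms-∈ {n} {n′} {P} {Q} {del} {ins} fwd) (onPerms-∈ {n′} {n} {Q} {P} {ins} {del} bwd)
    (onPerms-inverse {n} {n′} {P} {Q} {del} {ins} fwd) (onPerms-inverse {n′} {n} {Q} {P} {ins} {del} bwd)
  where
  onPerms : ℕ → (List (List ℕ) → List (List ℕ)) → List ℕ → List ℕ
  onPerms m f w = fromCycles m (f (cycles w))
  onPerms-∈ : ∀ {m m′ R S f g} → Transfer m m′ R S f g →
    ∀ {w} → w ∈ perms m → R (cycles w) ≡ true → onPerms m′ f w ∈ perms m′ × S (cycles (onPerms m′ f w)) ≡ true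
  onPerms-∈ {m} {m′} {S = S} t {w} w∈ r =
    let (form , s , _) = t (cycles w) (proj₁ (cycles-valid m w w∈)) r in
    fromCycles-∈-perms m′ _ form , subst (λ B → S B ≡ true) (sym (cycles-fromCycles m′ _ form)) s
  onPerms-inverse : ∀ {m m′ R S f g} → Transfer m m′ R S f g →
    ∀ {w} → w ∈ perms m → R (cycles w) ≡ true → onPerms m g (onPerms m′ f w) ≡ w
  onPerms-inverse {m} {m′} {g = g} t {w} w∈ r =
    let (form , _ , gf) = t (cycles w) (proj₁ (cycles-valid m w w∈)) r in
    trans (cong (fromCycles m ∘ g) (cycles-fromCycles m′ _ form)) (trans (cong (fromCycles m) gf) (fromCycles-cycles m w w∈))

derangement⇒nontrivial : ∀ n w B → IsPerm n w → CycleDecomposition n (app w) B → isDerangement w ≡ true → Nontrivial B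
derangement⇒nontrivial n w B (u , refl , r) (((uB , sub , cov) , hm) , cy) e = fixedPointFree⇒nontrivial cy f
  where
  f : ∀ {x} → x ∈ concat B → app w x ≢ x
  f {x} m eq with all-true⁻ (λ i → not (app w i ≡ᵇ i)) (range1 (length w)) e (sub m)
  ... | e' rewrite eq | ≡ᵇ-refl x with () ← e'

nontrivial⇒derangement : ∀ n w B → IsPerm n w → CycleDecomposition n (app w) B → Nontrivial B → isDerangement w ≡ true
nontrivial⇒derangement n w B (u , refl , r) (((uB , sub , cov) , hm) , cy) d = all-true⁺ _ (range1 (length w)) f
  where
  f : ∀ {y} → y ∈ range1 (length w) → not (app w y ≡ᵇ y) ≡ true
  f {y} m rewrite ≢⇒≡ᵇ-false (nontrivial⇒fixedPointFree cy uB d (cov m)) = refl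

nontrivialᵇ : List (List ℕ) → Bool
nontrivialᵇ [] = true
nontrivialᵇ (b ∷ B) = (2 ≤ᵇ length b) ∧ nontrivialᵇ B

nontrivialᵇ⇒nontrivial : ∀ B → nontrivialᵇ B ≡ true → Nontrivial B
nontrivialᵇ⇒nontrivial [] e = []
nontrivialᵇ⇒nontrivial (b ∷ B) e with 2 ≤ᵇ length b in e1
... | true = ≤ᵇ-true⇒≤ e1 ∷ nontrivialᵇ⇒nontrivial B e

nontrivial⇒nontrivialᵇ : ∀ B → Nontrivial B → nontrivialᵇ B ≡ true
nontrivial⇒nontrivialᵇ [] [] = refl
nontrivial⇒nontrivialᵇ (b ∷ B) (d ∷ ds) rewrite ≤⇒≤ᵇ-true d = nontrivial⇒nontrivialᵇ B ds

isDerangement≡nontrivialᵇ : ∀ n w → w ∈ perms n → isDerangement w ≡ nontrivialᵇ (cycles w)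
isDerangement≡nontrivialᵇ n w w∈ = ⇔→≡ {z = true} (mk⇔
  (nontrivial⇒nontrivialᵇ _ ∘ derangement⇒nontrivial n w _ (∈-perms⁻ w∈) (cycles-valid n w w∈))
  (nontrivial⇒derangement n w _ (∈-perms⁻ w∈) (cycles-valid n w w∈) ∘ nontrivialᵇ⇒nontrivial _))

μ≡length-cycles : ∀ w → μ w ≡ length (cycles w)
μ≡length-cycles w = sym (length-map (orbit w) (leaders w))

-- Relabelling, and the two deletions

punchOut : ℕ → ℕ → ℕ
punchOut i x = if i <ᵇ x then x ∸ 1 else x

punchIn : ℕ → ℕ → ℕ
punchIn i x = if i ≤ᵇ x then suc x else x

punchOut-≤ : ∀ {i x} → x ≤ i → punchOut i x ≡ x
punchOut-≤ {i} {x} le rewrite ≥⇒<ᵇ-false {i} {x} le = refl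

punchOut-> : ∀ {i x} → i < x → punchOut i x ≡ pred x
punchOut-> {i} {x} lt rewrite <⇒<ᵇ-true lt = refl

punchIn-< : ∀ {i x} → x < i → punchIn i x ≡ x
punchIn-< {i} {x} lt rewrite >⇒≤ᵇ-false {i} {x} lt = refl

punchIn-≥ : ∀ {i x} → i ≤ x → punchIn i x ≡ suc x
punchIn-≥ {i} {x} le rewrite ≤⇒≤ᵇ-true le = refl

punchOut-punchIn : ∀ i x → punchOut i (punchIn i x) ≡ x
punchOut-punchIn i x with <-cmp x i
... | tri< lt _ _ rewrite punchIn-< lt = punchOut-≤ (<⇒≤ lt)
... | tri≈ _ refl _ rewrite punchIn-≥ {i} {i} ≤-refl = punchOut-> (n<1+n i)
... | tri> _ _ gt rewrite punchIn-≥ (<⇒≤ gt) = punchOut-> (≤-trans gt (n≤1+n x))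

punchIn-punchOut : ∀ i x → x ≢ i → punchIn i (punchOut i x) ≡ x
punchIn-punchOut i x ne with <-cmp x i
... | tri< lt _ _ rewrite punchOut-≤ (<⇒≤ lt) = punchIn-< lt
... | tri≈ _ e _ = ⊥-elim (ne e)
punchIn-punchOut i (suc x) ne | tri> _ _ gt rewrite punchOut-> gt = punchIn-≥ (≤-pred gt)

punchIn≢ : ∀ i x → punchIn i x ≢ i
punchIn≢ i x with <-cmp x i
... | tri< lt _ _ rewrite punchIn-< lt = λ e → <-irrefl e lt
... | tri≈ _ refl _ rewrite punchIn-≥ {i} {i} ≤-refl = λ e → <-irrefl (sym e) (n<1+n i)
... | tri> _ _ gt rewrite punchIn-≥ (<⇒≤ gt) = λ e → <-irrefl (sym e) (≤-trans gt (n≤1+n x))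

punchIn-mono-< : ∀ i {x y} → x < y → punchIn i x < punchIn i y
punchIn-mono-< i {x} {y} lt with i ≤? x | i ≤? y
... | yes a | yes b rewrite punchIn-≥ a | punchIn-≥ b = s≤s lt
... | no a | no b rewrite punchIn-< (≰⇒> a) | punchIn-< (≰⇒> b) = lt
... | yes a | no b = ⊥-elim (<⇒≱ (≤-trans lt (<⇒≤ (≰⇒> b))) a)
... | no a | yes b rewrite punchIn-< (≰⇒> a) | punchIn-≥ b = ≤-trans lt (n≤1+n y)

punchOut-mono-< : ∀ i {x y} → x < y → x ≢ i → y ≢ i → punchOut i x < punchOut i y
punchOut-mono-< i {x} {y} lt nx ny with i <? x | i <? y
punchOut-mono-< i {suc x} {suc y} lt nx ny | yes a | yes b rewrite punchOut-> a | punchOut-> b = ≤-pred lt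
... | no a | no b rewrite punchOut-≤ (≮⇒≥ a) | punchOut-≤ (≮⇒≥ b) = lt
... | yes a | no b = ⊥-elim (<⇒≱ (<-trans a lt) (≮⇒≥ b))
punchOut-mono-< i {x} {suc y} lt nx ny | no a | yes b rewrite punchOut-≤ (≮⇒≥ a) | punchOut-> b = ≤-trans (≤∧≢⇒< (≮⇒≥ a) nx) (≤-pred b)

<ᵇ-preserved : ∀ (σ : ℕ → ℕ) {x y} → (x < y → σ x < σ y) → (y < x → σ y < σ x) → (x <ᵇ y) ≡ (σ x <ᵇ σ y)
<ᵇ-preserved σ {x} {y} f g with <-cmp x y
... | tri< lt _ _ rewrite <⇒<ᵇ-true lt | <⇒<ᵇ-true (f lt) = refl
... | tri≈ _ refl _ rewrite ≥⇒<ᵇ-false {x} {x} ≤-refl | ≥⇒<ᵇ-false {σ x} {σ x} ≤-refl = refl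
... | tri> _ _ gt rewrite ≥⇒<ᵇ-false {x} {y} (<⇒≤ gt) | ≥⇒<ᵇ-false {σ x} {σ y} (<⇒≤ (g gt)) = refl

punchOut-∈-range1 : ∀ {n i y} → 1 ≤ i → i ≤ suc n → y ∈ range1 (suc n) → y ≢ i → punchOut i y ∈ range1 n
punchOut-∈-range1 {n} {i} {y} i1 in' m ne with ∈-range1⁻ m | <-cmp y i
... | y1 , yn | tri< lt _ _ rewrite punchOut-≤ (<⇒≤ lt) = ∈-range1⁺ y1 (≤-pred (≤-trans lt in'))
... | _ | tri≈ _ e _ = ⊥-elim (ne e)
punchOut-∈-range1 {n} {i} {suc y} i1 in' m ne | y1 , yn | tri> _ _ gt rewrite punchOut-> gt = ∈-range1⁺ (≤-trans i1 (≤-pred gt)) (≤-pred yn)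

punchIn-∈-range1 : ∀ {n i x} → x ∈ range1 n → punchIn i x ∈ range1 (suc n)
punchIn-∈-range1 {n} {i} {x} m with ∈-range1⁻ m | i ≤? x
... | x1 , xn | yes le rewrite punchIn-≥ le = ∈-range1⁺ (≤-trans x1 (n≤1+n x)) (s≤s xn)
... | x1 , xn | no nle rewrite punchIn-< (≰⇒> nle) = ∈-range1⁺ x1 (≤-trans xn (n≤1+n n))

arrangement-punchOut : ∀ {n i L} → Arrangement (suc n) (i ∷ L) → Arrangement n (map (punchOut i) L)
arrangement-punchOut {n} {i} {L} (u@(_ ∷ u') , s , c) = uq , sb , cv
  where
  ≢i : ∀ {x} → x ∈ L → x ≢ i
  ≢i m e = head∉tail u (subst (_∈ L) e m)
  irng = ∈-range1⁻ (s (here refl))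
  uq : Unique (map (punchOut i) L)
  uq = map⁺-unique (punchOut i) L u' (λ {x} {y} mx my e → trans (sym (punchIn-punchOut i x (≢i mx))) (trans (cong (punchIn i) e) (punchIn-punchOut i y (≢i my))))
  sb : ∀ {z} → z ∈ map (punchOut i) L → z ∈ range1 n
  sb m with ∈-map⁻ (punchOut i) m
  ... | x , mx , refl = punchOut-∈-range1 (proj₁ irng) (proj₂ irng) (s (there mx)) (≢i mx)
  cv : ∀ {z} → z ∈ range1 n → z ∈ map (punchOut i) L
  cv {z} m with c (punchIn-∈-range1 {i = i} m)
  ... | here e = ⊥-elim (punchIn≢ i z e)
  ... | there m' = subst (_∈ map (punchOut i) L) (punchOut-punchIn i z) (∈-map⁺ (punchOut i) m')

arrangement-punchIn : ∀ {n i L} → Arrangement n L → 1 ≤ i → i ≤ suc n → Arrangement (suc n) (i ∷ map (punchIn i) L)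
arrangement-punchIn {n} {i} {L} (u , s , c) i1 in' = uq , sb , cv
  where
  ≢i : ∀ {z} → z ∈ map (punchIn i) L → z ≢ i
  ≢i m with ∈-map⁻ (punchIn i) m
  ... | x , _ , refl = punchIn≢ i x
  uq : Unique (i ∷ map (punchIn i) L)
  uq = All.tabulate (λ m e → ≢i m (sym e)) ∷ map⁺-unique (punchIn i) L u (λ {x} {y} _ _ e → trans (sym (punchOut-punchIn i x)) (trans (cong (punchOut i) e) (punchOut-punchIn i y)))
  sb : ∀ {z} → z ∈ i ∷ map (punchIn i) L → z ∈ range1 (suc n)
  sb (here refl) = ∈-range1⁺ i1 in'
  sb (there m) with ∈-map⁻ (punchIn i) m
  ... | x , mx , refl = punchIn-∈-range1 {i = i} (s mx)
  cv : ∀ {z} → z ∈ range1 (suc n) → z ∈ i ∷ map (punchIn i) L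
  cv {z} m with z ≟ i
  ... | yes refl = here refl
  ... | no ne = there (subst (_∈ map (punchIn i) L) (punchIn-punchOut i z ne) (∈-map⁺ (punchIn i) (c (punchOut-∈-range1 i1 in' m ne))))

arrangement-swap : ∀ {n x y L} → Arrangement n (x ∷ y ∷ L) → Arrangement n (y ∷ x ∷ L)
arrangement-swap {n} {x} {y} {L} ((a ∷ b ∷ u) , s , c) = (All.tabulate g ∷ All.tabulate h ∷ u) , s' , c'
  where
  g : ∀ {z} → z ∈ x ∷ L → y ≢ z
  g (here refl) e = All.lookup a (here refl) (sym e)
  g (there m) = All.lookup b m
  h : ∀ {z} → z ∈ L → x ≢ z
  h m = All.lookup a (there m)
  s' : ∀ {z} → z ∈ y ∷ x ∷ L → z ∈ range1 n
  s' (here refl) = s (there (here refl))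
  s' (there (here refl)) = s (here refl)
  s' (there (there m)) = s (there (there m))
  c' : ∀ {z} → z ∈ range1 n → z ∈ y ∷ x ∷ L
  c' m with c m
  ... | here e = there (here e)
  ... | there (here e) = here e
  ... | there (there m') = there (there m')

standard-map : ∀ (σ : ℕ → ℕ) B → Standard B → (∀ {x y} → x ∈ concat B → y ∈ concat B → x < y → σ x < σ y) → Standard (map (map σ) B)
standard-map σ [] std[] mono = std[]
standard-map σ ((h ∷ t) ∷ B) (std∷ a aa hm) mono =
  std∷ (All.tabulate above-tail) (All.tabulate above-rest) (standard-map σ B hm (λ mx my → mono (∈-++⁺ʳ (h ∷ t) mx) (∈-++⁺ʳ (h ∷ t) my)))
  where
  above-tail : ∀ {z} → z ∈ map σ t → σ h < z
  above-tail m with ∈-map⁻ σ m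
  ... | x , mx , refl = mono (here refl) (there (∈-++⁺ˡ mx)) (All.lookup a mx)
  above-cycle : ∀ {b} → b ∈ B → ∀ {z} → z ∈ map σ b → σ h < z
  above-cycle {b} mb m' with ∈-map⁻ σ m'
  ... | x , mx , refl = mono (here refl) (∈-++⁺ʳ (h ∷ t) (∈-concat⁺′ mx mb)) (All.lookup (All.lookup aa mb) mx)
  above-rest : ∀ {b} → b ∈ map (map σ) B → All (σ h <_) b
  above-rest m with ∈-map⁻ (map σ) m
  ... | b , mb , refl = All.tabulate (above-cycle mb)

avoids31-2-map : ∀ (σ : ℕ → ℕ) L → (∀ {x y} → x ∈ L → y ∈ L → (x <ᵇ y) ≡ (σ x <ᵇ σ y)) → avoids31-2 (map σ L) ≡ avoids31-2 L
avoids31-2-map σ [] f = refl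
avoids31-2-map σ (a ∷ []) f = refl
avoids31-2-map σ (a ∷ b ∷ rest) f =
  cong₂ _∧_ (cong not (trans (any-map _ σ rest) (any-cong _ _ rest (λ m → sym (cong₂ _∧_ (f (there (here refl)) (there (there m))) (f (there (there m)) (here refl)))))))
            (avoids31-2-map σ (b ∷ rest) (λ mx my → f (there mx) (there my)))

avoids31-2-tail : ∀ a L → avoids31-2 (a ∷ L) ≡ true → avoids31-2 L ≡ true
avoids31-2-tail a [] e = refl
avoids31-2-tail a (b ∷ L) e = ∧-conicalʳ (not (any _ L)) _ e

nothingBelow1 : ∀ b c → ((b <ᵇ c) ∧ (c <ᵇ 1)) ≡ false
nothingBelow1 b zero = refl
nothingBelow1 b (suc c) = ∧-zeroʳ (b <ᵇ suc c)

avoids31-2-after1 : ∀ b L → avoids31-2 (1 ∷ b ∷ L) ≡ avoids31-2 (b ∷ L)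
avoids31-2-after1 b L rewrite any-false⁺ (λ c → (b <ᵇ c) ∧ (c <ᵇ 1)) L (λ {z} _ → nothingBelow1 b z) = refl

nothingBetween : ∀ a z i → i ∸ 1 ≤ a → ((a <ᵇ z) ∧ (z <ᵇ i)) ≡ false
nothingBetween a z i le with a <ᵇ z in e
... | false = refl
... | true = ≥⇒<ᵇ-false {z} {i} (≤-trans (m∸n≤m+? i) (≤-trans (s≤s le) (<ᵇ-true⇒< e)))
  where
  m∸n≤m+? : ∀ i → i ≤ suc (i ∸ 1)
  m∸n≤m+? zero = z≤n
  m∸n≤m+? (suc i) = ≤-refl

Qualifies : (ℕ → Bool) → (ℕ → Bool) → List (List ℕ) → Bool
Qualifies second? cycles? B = nontrivialᵇ B ∧ avoids31-2 (concat B) ∧ second? (nth (concat B) 1) ∧ cycles? (length B)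

secondIs : ℕ → ℕ → List (List ℕ) → Bool
secondIs i k = Qualifies (_≡ᵇ i) (_≡ᵇ k)

secondFrom : ℕ → ℕ → List (List ℕ) → Bool
secondFrom a k = Qualifies (a ≤ᵇ_) (_≡ᵇ k)

secondFromWithExtraCycle : ℕ → ℕ → List (List ℕ) → Bool
secondFromWithExtraCycle a k = Qualifies (a ≤ᵇ_) (λ l → suc l ≡ᵇ k)

firstCycleLength : List (List ℕ) → ℕ
firstCycleLength [] = 0
firstCycleLength (b ∷ _) = length b

-- max 2 (i ∸ 1): by thirdLetter-bound, the least possible second letter once i is deleted and the letters closed up.
minSecondAfterDeletion : ℕ → ℕ
minSecondAfterDeletion (suc (suc (suc j))) = suc (suc j)
minSecondAfterDeletion _ = 2

deleteSecond : ℕ → List (List ℕ) → List (List ℕ)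
deleteSecond i ((h ∷ x ∷ t) ∷ R) = map (map (punchOut i)) ((h ∷ t) ∷ R)
deleteSecond i _ = []

insertSecond : ℕ → List (List ℕ) → List (List ℕ)
insertSecond i ((h ∷ t) ∷ R) = (punchIn i h ∷ i ∷ map (punchIn i) t) ∷ map (map (punchIn i)) R
insertSecond i _ = []

squeeze₂ : ℕ → ℕ → ℕ
squeeze₂ i z = punchOut 1 (punchOut i z)

spread₂ : ℕ → ℕ → ℕ
spread₂ i z = punchIn i (punchIn 1 z)

dropFirstCycle : ℕ → List (List ℕ) → List (List ℕ)
dropFirstCycle i ((h ∷ x ∷ []) ∷ R) = map (map (squeeze₂ i)) R
dropFirstCycle i _ = []

addFirstCycle : ℕ → List (List ℕ) → List (List ℕ)
addFirstCycle i B = (1 ∷ i ∷ []) ∷ map (map (spread₂ i)) B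

module _ (second? cycles? : ℕ → Bool) (B : List (List ℕ)) (q : Qualifies second? cycles? B ≡ true) where
  private
    nt = nontrivialᵇ B
    av = avoids31-2 (concat B)
    sc = second? (nth (concat B) 1)
    cy = cycles? (length B)
  qualifies-nontrivial : nt ≡ true
  qualifies-nontrivial = ∧-conicalˡ nt _ q
  qualifies-avoids : av ≡ true
  qualifies-avoids = ∧-conicalˡ av _ (∧-conicalʳ nt _ q)
  qualifies-second : sc ≡ true
  qualifies-second = ∧-conicalˡ sc _ (∧-conicalʳ av _ (∧-conicalʳ nt _ q))
  qualifies-cycles : cy ≡ true
  qualifies-cycles = ∧-conicalʳ sc _ (∧-conicalʳ av _ (∧-conicalʳ nt _ q))

nontrivialᵇ-map : ∀ (σ : ℕ → ℕ) B → nontrivialᵇ (map (map σ) B) ≡ nontrivialᵇ B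
nontrivialᵇ-map σ [] = refl
nontrivialᵇ-map σ (b ∷ B) = cong₂ _∧_ (cong (2 ≤ᵇ_) (length-map σ b)) (nontrivialᵇ-map σ B)

map-map-inverse : ∀ (f g : ℕ → ℕ) B → (∀ {x} → x ∈ concat B → f (g x) ≡ x) → map (map f) (map (map g) B) ≡ B
map-map-inverse f g [] e = refl
map-map-inverse f g (b ∷ B) e = cong₂ _∷_ (trans (sym (map-∘ b)) (map-id-local (All.tabulate (λ m → e (∈-++⁺ˡ m)))))
                                  (map-map-inverse f g B (λ m → e (∈-++⁺ʳ b m)))

range1-≥1 : ∀ {n x} → x ∈ range1 n → 1 ≤ x
range1-≥1 m = proj₁ (∈-range1⁻ m)

head≤ : ∀ {h t R x} → Standard ((h ∷ t) ∷ R) → x ∈ concat ((h ∷ t) ∷ R) → h ≤ x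
head≤ {h} {t} (std∷ h<t h<R _) x∈ with ∈-++⁻ (h ∷ t) x∈
... | inj₁ (here refl) = ≤-refl
... | inj₁ (there x∈t) = <⇒≤ (All.lookup h<t x∈t)
... | inj₂ x∈R = let (b , x∈b , b∈R) = ∈-concat⁻′ _ x∈R in <⇒≤ (All.lookup (All.lookup h<R b∈R) x∈b)

firstCycle-starts-1 : ∀ {m B} → CycleForm (suc m) B → ∃ λ t → ∃ λ R → B ≡ (1 ∷ t) ∷ R
firstCycle-starts-1 {m} {[]} ((_ , _ , cov) , _) with () ← cov (∈-range1⁺ {suc m} ≤-refl (s≤s z≤n))
firstCycle-starts-1 {m} {(h ∷ t) ∷ R} ((_ , sub , cov) , std)
  with ≤-antisym (head≤ std (cov (∈-range1⁺ {suc m} ≤-refl (s≤s z≤n)))) (range1-≥1 (sub (here refl)))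
... | refl = t , R , refl

firstCycle-shape : ∀ {m B} → CycleForm (suc m) B → nontrivialᵇ B ≡ true → ∃ λ x → ∃ λ t → ∃ λ R → B ≡ (1 ∷ x ∷ t) ∷ R
firstCycle-shape v d with firstCycle-starts-1 v
... | [] , R , refl with () ← d
... | x ∷ t , R , refl = x , t , R , refl

second-≤ : ∀ {m B} → CycleForm m B → nth (concat B) 1 ≤ m
second-≤ {m} {B} ((u , s , c) , hm) = go (concat B) s
  where
  go : ∀ L → (∀ {x} → x ∈ L → x ∈ range1 m) → nth L 1 ≤ m
  go [] _ = z≤n
  go (a ∷ []) _ = z≤n
  go (a ∷ b ∷ L) sb = proj₂ (∈-range1⁻ (sb (there (here refl))))

second-≥2 : ∀ {m B} → CycleForm (suc m) B → nontrivialᵇ B ≡ true → 2 ≤ nth (concat B) 1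
second-≥2 v@((u , s , c) , hm) d with firstCycle-shape v d
... | x , t , R , refl = ≤∧≢⇒< (range1-≥1 (s (there (here refl)))) (λ e → head∉tail u (here e))

pred< : ∀ i → 1 ≤ i → i ∸ 1 < i
pred< (suc i) _ = ≤-refl

thirdLetter-bound : ∀ {N} i c rest → 2 ≤ i → Arrangement N (1 ∷ i ∷ c ∷ rest) → avoids31-2 (i ∷ c ∷ rest) ≡ true → i ∸ 1 ≤ c
thirdLetter-bound {N} i c rest 2≤i (u , s , cv) av with (i ∸ 1) ≤? c
... | yes le = le
... | no nle = ⊥-elim (true≢false (trans (sym av) (cong (_∧ avoids31-2 (c ∷ rest)) (cong not anyT))))
  where
  lt : c < i ∸ 1
  lt = ≰⇒> nle
  c1 : 1 ≤ c
  c1 = range1-≥1 (s (there (there (here refl))))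
  p2 : 2 ≤ i ∸ 1
  p2 = ≤-trans (s≤s c1) lt
  pi : i ∸ 1 < i
  pi = pred< i (≤-trans (s≤s z≤n) 2≤i)
  pin : i ∸ 1 ∈ range1 N
  pin = ∈-range1⁺ (≤-trans (s≤s z≤n) p2) (≤-trans (<⇒≤ pi) (proj₂ (∈-range1⁻ (s (there (here refl))))))
  inrest : i ∸ 1 ∈ rest
  inrest with cv pin
  ... | here e = ⊥-elim (<⇒≱ p2 (≤-reflexive e))
  ... | there (here e) = ⊥-elim (<-irrefl e pi)
  ... | there (there (here e)) = ⊥-elim (<-irrefl (sym e) lt)
  ... | there (there (there m)) = m
  anyT : any (λ z → (c <ᵇ z) ∧ (z <ᵇ i)) rest ≡ true
  anyT = any-true⁺ _ rest inrest (cong₂ _∧_ (<⇒<ᵇ-true lt) (<⇒<ᵇ-true pi))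

minSecondAfterDeletion-≤ : ∀ i c → 2 ≤ i → i ∸ 1 ≤ c → c ≢ i → c ≢ 1 → minSecondAfterDeletion i ≤ punchOut i c
minSecondAfterDeletion-≤ zero c () le ne n1
minSecondAfterDeletion-≤ (suc zero) c (s≤s ()) le ne n1
minSecondAfterDeletion-≤ (suc (suc zero)) c 2≤i le ne n1 with <-cmp c 2
... | tri< lt _ _ = ⊥-elim (n1 (≤-antisym (≤-pred lt) le))
... | tri≈ _ e _ = ⊥-elim (ne e)
minSecondAfterDeletion-≤ (suc (suc zero)) (suc c) 2≤i le ne n1 | tri> _ _ gt rewrite punchOut-> gt = ≤-pred gt
minSecondAfterDeletion-≤ (suc (suc (suc j))) c 2≤i le ne n1 with <-cmp c (suc (suc (suc j)))
... | tri< lt _ _ rewrite punchOut-≤ (<⇒≤ lt) = le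
... | tri≈ _ e _ = ⊥-elim (ne e)
minSecondAfterDeletion-≤ (suc (suc (suc j))) (suc c) 2≤i le ne n1 | tri> _ _ gt rewrite punchOut-> gt = ≤-trans (n≤1+n _) (≤-pred gt)

minSecondAfterDeletion-≥ : ∀ i → i ∸ 1 ≤ minSecondAfterDeletion i
minSecondAfterDeletion-≥ zero = z≤n
minSecondAfterDeletion-≥ (suc zero) = z≤n
minSecondAfterDeletion-≥ (suc (suc zero)) = s≤s z≤n
minSecondAfterDeletion-≥ (suc (suc (suc j))) = ≤-refl

punchOut-<ᵇ : ∀ i L → (∀ {x} → x ∈ L → x ≢ i) → ∀ {x y} → x ∈ L → y ∈ L → (x <ᵇ y) ≡ (punchOut i x <ᵇ punchOut i y)
punchOut-<ᵇ i L ≢i mx my = <ᵇ-preserved (punchOut i) (λ lt → punchOut-mono-< i lt (≢i mx) (≢i my)) (λ lt → punchOut-mono-< i lt (≢i my) (≢i mx))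

punchIn-<ᵇ : ∀ i {x y} → (x <ᵇ y) ≡ (punchIn i x <ᵇ punchIn i y)
punchIn-<ᵇ i = <ᵇ-preserved (punchIn i) (punchIn-mono-< i) (punchIn-mono-< i)

deleteSecond-transfer : ∀ i m k B → 2 ≤ i → CycleForm (suc m) B → secondIs i k B ≡ true → 3 ≤ firstCycleLength B →
  CycleForm m (deleteSecond i B) × secondFrom (minSecondAfterDeletion i) k (deleteSecond i B) ≡ true × insertSecond i (deleteSecond i B) ≡ B
deleteSecond-transfer i m k B 2≤i v p f3 with firstCycle-shape v (qualifies-nontrivial (_≡ᵇ i) (_≡ᵇ k) B p)
deleteSecond-transfer i m k B 2≤i v p (s≤s (s≤s ())) | x , [] , R , refl
deleteSecond-transfer i m k B 2≤i v@((u , s , cv) , std∷ (_ ∷ a) aa hm) p f3 | x , c ∷ r , R , refl with ≡ᵇ-true⇒≡ {x} {i} (qualifies-second (_≡ᵇ i) (_≡ᵇ k) ((1 ∷ x ∷ c ∷ r) ∷ R) p)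
... | refl = (arrangement′ , standard′) , qualifies′ , inverse
  where
  rest = r ++ concat R
  W = 1 ∷ i ∷ c ∷ rest
  arrangement : Arrangement (suc m) W
  arrangement = u , s , cv
  ≢i : ∀ {z} → z ∈ 1 ∷ c ∷ rest → z ≢ i
  ≢i (here refl) e = <-irrefl e 2≤i
  ≢i (there mz) e = head∉tail (tail-unique u) (subst (_∈ _) e mz)
    where
    tail-unique : ∀ {z : ℕ} {zs} → Unique (z ∷ zs) → Unique zs
    tail-unique (_ ∷ q) = q
  arrangement′ : Arrangement m (concat (deleteSecond i ((1 ∷ i ∷ c ∷ r) ∷ R)))
  arrangement′ = subst (Arrangement m) (sym (concat-map {f = (punchOut i)} ((1 ∷ c ∷ r) ∷ R))) (arrangement-punchOut (arrangement-swap arrangement))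
  standard′ : Standard (deleteSecond i ((1 ∷ i ∷ c ∷ r) ∷ R))
  standard′ = standard-map (punchOut i) ((1 ∷ c ∷ r) ∷ R) (std∷ a aa hm) (λ mx my lt → punchOut-mono-< i lt (≢i mx) (≢i my))
  avoids = qualifies-avoids (_≡ᵇ i) (_≡ᵇ k) ((1 ∷ i ∷ c ∷ r) ∷ R) p
  av : avoids31-2 (concat (deleteSecond i ((1 ∷ i ∷ c ∷ r) ∷ R))) ≡ true
  av = trans (cong avoids31-2 (concat-map {f = (punchOut i)} ((1 ∷ c ∷ r) ∷ R)))
         (trans (avoids31-2-map (punchOut i) (1 ∷ c ∷ rest) (punchOut-<ᵇ i _ ≢i))
           (trans (avoids31-2-after1 c rest) (avoids31-2-tail i (c ∷ rest) (avoids31-2-tail 1 (i ∷ c ∷ rest) avoids))))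
  c≥i∸1 : i ∸ 1 ≤ c
  c≥i∸1 = thirdLetter-bound i c rest 2≤i arrangement (avoids31-2-tail 1 (i ∷ c ∷ rest) avoids)
  sec : minSecondAfterDeletion i ≤ nth (concat (deleteSecond i ((1 ∷ i ∷ c ∷ r) ∷ R))) 1
  sec = subst (λ L → minSecondAfterDeletion i ≤ nth L 1) (sym (concat-map {f = (punchOut i)} ((1 ∷ c ∷ r) ∷ R)))
          (minSecondAfterDeletion-≤ i c 2≤i c≥i∸1 (≢i (there (here refl))) (λ e → head∉tail u (there (here (sym e)))))
  nontrivial′ : nontrivialᵇ (deleteSecond i ((1 ∷ i ∷ c ∷ r) ∷ R)) ≡ true
  nontrivial′ = trans (nontrivialᵇ-map (punchOut i) ((1 ∷ c ∷ r) ∷ R)) (∧-conicalʳ (2 ≤ᵇ length (1 ∷ i ∷ c ∷ r)) _ (qualifies-nontrivial (_≡ᵇ i) (_≡ᵇ k) ((1 ∷ i ∷ c ∷ r) ∷ R) p))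
  len : length (deleteSecond i ((1 ∷ i ∷ c ∷ r) ∷ R)) ≡ length ((1 ∷ i ∷ c ∷ r) ∷ R)
  len = length-map (map (punchOut i)) ((1 ∷ c ∷ r) ∷ R)
  qualifies′ : secondFrom (minSecondAfterDeletion i) k (deleteSecond i ((1 ∷ i ∷ c ∷ r) ∷ R)) ≡ true
  qualifies′ = cong₂ _∧_ nontrivial′ (cong₂ _∧_ av (cong₂ _∧_ (≤⇒≤ᵇ-true sec) (trans (cong (_≡ᵇ k) len) (qualifies-cycles (_≡ᵇ i) (_≡ᵇ k) ((1 ∷ i ∷ c ∷ r) ∷ R) p))))
  inverse : insertSecond i (deleteSecond i ((1 ∷ i ∷ c ∷ r) ∷ R)) ≡ (1 ∷ i ∷ c ∷ r) ∷ R
  inverse = cong₂ _∷_ (cong₂ _∷_ (punchIn-punchOut i 1 (≢i (here refl))) (cong (i ∷_) (trans (sym (map-∘ (c ∷ r))) (map-id-local (All.tabulate (λ mz → punchIn-punchOut i _ (≢i (there (∈-++⁺ˡ mz)))))))))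
                  (map-map-inverse (punchIn i) (punchOut i) R (λ mz → punchIn-punchOut i _ (≢i (there (there (∈-++⁺ʳ r mz))))))

minSecondAfterDeletion-≥2 : ∀ i → 2 ≤ minSecondAfterDeletion i
minSecondAfterDeletion-≥2 zero = s≤s (s≤s z≤n)
minSecondAfterDeletion-≥2 (suc zero) = s≤s (s≤s z≤n)
minSecondAfterDeletion-≥2 (suc (suc zero)) = s≤s (s≤s z≤n)
minSecondAfterDeletion-≥2 (suc (suc (suc j))) = s≤s (s≤s z≤n)

punchIn-≥-self : ∀ i x → x ≤ punchIn i x
punchIn-≥-self i x with i ≤? x
... | yes le rewrite punchIn-≥ le = n≤1+n x
... | no nle rewrite punchIn-< (≰⇒> nle) = ≤-refl

≤-suc-pred : ∀ i → i ≤ suc (i ∸ 1)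
≤-suc-pred zero = z≤n
≤-suc-pred (suc i) = ≤-refl

standard-insert : ∀ {i h t R} → Standard ((h ∷ t) ∷ R) → h < i → Standard ((h ∷ i ∷ t) ∷ R)
standard-insert (std∷ a aa hm) lt = std∷ (lt ∷ a) aa hm

insertSecond-transfer : ∀ i m k B → 2 ≤ i → CycleForm m B → secondFrom (minSecondAfterDeletion i) k B ≡ true →
  CycleForm (suc m) (insertSecond i B) × secondIs i k (insertSecond i B) ≡ true × 3 ≤ firstCycleLength (insertSecond i B) × deleteSecond i (insertSecond i B) ≡ B
insertSecond-transfer i zero k B 2≤i v q
  with () ← ≤-trans (≤-trans (minSecondAfterDeletion-≥2 i) (≤ᵇ-true⇒≤ (qualifies-second (minSecondAfterDeletion i ≤ᵇ_) (_≡ᵇ k) B q))) (second-≤ v)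
insertSecond-transfer i (suc m) k B 2≤i v q with firstCycle-shape v (qualifies-nontrivial (minSecondAfterDeletion i ≤ᵇ_) (_≡ᵇ k) B q)
insertSecond-transfer i (suc m) k B 2≤i v@((u , s , cv) , hm) q | c , r , R , refl = (arrangement′ , standard′) , cong₂ _∧_ nontrivial′ (cong₂ _∧_ avoids′ (cong₂ _∧_ (≡ᵇ-refl i) cycles′)) , s≤s (s≤s (s≤s z≤n)) , inverse
  where
  B0 = (1 ∷ c ∷ r) ∷ R
  rest = r ++ concat R
  arrangement : Arrangement (suc m) (1 ∷ c ∷ rest)
  arrangement = u , s , cv
  sec : minSecondAfterDeletion i ≤ c
  sec = ≤ᵇ-true⇒≤ (qualifies-second (minSecondAfterDeletion i ≤ᵇ_) (_≡ᵇ k) B0 q)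
  cle : c ≤ suc m
  cle = second-≤ v
  ile : i ≤ suc (suc m)
  ile = ≤-trans (≤-suc-pred i) (s≤s (≤-trans (minSecondAfterDeletion-≥ i) (≤-trans sec cle)))
  i1 : punchIn i 1 ≡ 1
  i1 = punchIn-< 2≤i
  ceq : concat (insertSecond i B0) ≡ punchIn i 1 ∷ i ∷ map (punchIn i) (c ∷ rest)
  ceq = cong (λ L → punchIn i 1 ∷ i ∷ L) (trans (cong (map (punchIn i) (c ∷ r) ++_) (concat-map {f = (punchIn i)} R)) (sym (map-++ (punchIn i) (c ∷ r) (concat R))))
  arrangement′ : Arrangement (suc (suc m)) (concat (insertSecond i B0))
  arrangement′ = subst (Arrangement (suc (suc m))) (sym ceq) (arrangement-swap (arrangement-punchIn arrangement (≤-trans (s≤s z≤n) 2≤i) ile))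
  standard′ : Standard (insertSecond i B0)
  standard′ = standard-insert (standard-map (punchIn i) B0 hm (λ _ _ lt → punchIn-mono-< i lt)) (subst (_< i) (sym i1) 2≤i)
  nontrivial′ : nontrivialᵇ (insertSecond i B0) ≡ true
  nontrivial′ = trans (nontrivialᵇ-map (punchIn i) R) (∧-conicalʳ (2 ≤ᵇ length (1 ∷ c ∷ r)) _ (qualifies-nontrivial (minSecondAfterDeletion i ≤ᵇ_) (_≡ᵇ k) B0 q))
  avoids′ : avoids31-2 (concat (insertSecond i B0)) ≡ true
  avoids′ = trans (cong avoids31-2 ceq) (trans (cong (λ z → avoids31-2 (z ∷ i ∷ map (punchIn i) (c ∷ rest))) i1)
          (trans (avoids31-2-after1 i (map (punchIn i) (c ∷ rest)))
            (cong₂ _∧_ (false⇒not-true (any-false⁺ _ (map (punchIn i) rest) (λ {z} _ → nothingBetween (punchIn i c) z i (≤-trans (minSecondAfterDeletion-≥ i) (≤-trans sec (punchIn-≥-self i c))))))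
                 (trans (avoids31-2-map (punchIn i) (c ∷ rest) (λ _ _ → punchIn-<ᵇ i)) (trans (sym (avoids31-2-after1 c rest)) (qualifies-avoids (minSecondAfterDeletion i ≤ᵇ_) (_≡ᵇ k) B0 q))))))
  cycles′ : (length (insertSecond i B0) ≡ᵇ k) ≡ true
  cycles′ = trans (cong (λ z → suc z ≡ᵇ k) (length-map (map (punchIn i)) R)) (qualifies-cycles (minSecondAfterDeletion i ≤ᵇ_) (_≡ᵇ k) B0 q)
  inverse : deleteSecond i (insertSecond i B0) ≡ B0
  inverse = cong₂ _∷_ (cong₂ _∷_ (punchOut-punchIn i 1) (trans (sym (map-∘ (c ∷ r))) (map-id-local (All.tabulate (λ {z} _ → punchOut-punchIn i z)))))
                  (map-map-inverse (punchOut i) (punchIn i) R (λ {z} _ → punchOut-punchIn i z))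

-- Were the first cycle (1 i), the next leader h would be at most 2 (2 lies in a later cycle), while thirdLetter-bound gives h ≥ i ∸ 1 ≥ 3.
firstCycle-long : ∀ i m k B → 4 ≤ i → CycleForm (suc m) B → secondIs i k B ≡ true → 3 ≤ firstCycleLength B
firstCycle-long i m k B 4≤i v p with firstCycle-shape v (qualifies-nontrivial (_≡ᵇ i) (_≡ᵇ k) B p)
... | x , c ∷ t , R , refl = s≤s (s≤s (s≤s z≤n))
firstCycle-long i m k B 4≤i v@((u , s , cv) , std∷ _ _ hmR) p | x , [] , R , refl with ≡ᵇ-true⇒≡ {x} {i} (qualifies-second (_≡ᵇ i) (_≡ᵇ k) ((1 ∷ x ∷ []) ∷ R) p)
... | refl = ⊥-elim (go R hmR (cv (∈-range1⁺ (s≤s z≤n) (≤-trans (s≤s (s≤s z≤n)) (≤-trans 4≤i (proj₂ (∈-range1⁻ (s (there (here refl))))))))) (u , s , cv) (qualifies-avoids (_≡ᵇ i) (_≡ᵇ k) ((1 ∷ i ∷ []) ∷ R) p))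
  where
  i≤3 : 3 ≤ i ∸ 1
  i≤3 = ∸-monoˡ-≤ 1 4≤i
  go : ∀ R → Standard R → 2 ∈ 1 ∷ i ∷ concat R → Arrangement (suc m) (1 ∷ i ∷ concat R) →
       avoids31-2 (1 ∷ i ∷ concat R) ≡ true → ⊥
  go R hR (here ()) L av
  go R hR (there (here e)) L av = <-irrefl e (≤-trans (s≤s (s≤s (s≤s z≤n))) 4≤i)
  go [] std[] (there (there ())) L av
  go ((h ∷ t) ∷ R') (std∷ a aa hm) (there (there m2)) L av = <⇒≱ (s≤s h≤2) (≤-trans i≤3 hb)
    where
    hb : i ∸ 1 ≤ h
    hb = thirdLetter-bound i h (t ++ concat R') (≤-trans (s≤s (s≤s z≤n)) 4≤i) L (avoids31-2-tail 1 (i ∷ h ∷ (t ++ concat R')) av)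
    h≤2 : h ≤ 2
    h≤2 = head≤ (std∷ a aa hm) m2

squeeze₂-spread₂ : ∀ i x → squeeze₂ i (spread₂ i x) ≡ x
squeeze₂-spread₂ i x = trans (cong (punchOut 1) (punchOut-punchIn i (punchIn 1 x))) (punchOut-punchIn 1 x)

dropFirstCycle-transfer : ∀ i m k B → 2 ≤ i → i ≤ 3 → CycleForm (suc (suc (suc m))) B → secondIs i k B ≡ true → (3 ≤ᵇ firstCycleLength B) ≡ false →
  CycleForm (suc m) (dropFirstCycle i B) × secondFromWithExtraCycle 2 k (dropFirstCycle i B) ≡ true × addFirstCycle i (dropFirstCycle i B) ≡ B
dropFirstCycle-transfer i m k B 2≤i i≤3 v p f with firstCycle-shape v (qualifies-nontrivial (_≡ᵇ i) (_≡ᵇ k) B p)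
dropFirstCycle-transfer i m k B 2≤i i≤3 v p () | x , c ∷ t , R , refl
dropFirstCycle-transfer i m k B 2≤i i≤3 v@((u , s , cv) , std∷ _ _ hmR) p f | x , [] , R , refl with ≡ᵇ-true⇒≡ {x} {i} (qualifies-second (_≡ᵇ i) (_≡ᵇ k) ((1 ∷ x ∷ []) ∷ R) p)
... | refl = (arrangement′ , standard′) , cong₂ _∧_ nontrivial′ (cong₂ _∧_ avoids′ (cong₂ _∧_ (≤⇒≤ᵇ-true (second-≥2 ((arrangement′ , standard′)) nontrivial′)) cycles′)) , inverse
  where
  B0 = (1 ∷ i ∷ []) ∷ R
  arrangement : Arrangement (suc (suc (suc m))) (1 ∷ i ∷ concat R)
  arrangement = u , s , cv
  ≢i : ∀ {x} → x ∈ concat R → x ≢ i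
  ≢i mx e = head∉tail (tail-unique u) (subst (_∈ _) e mx)
    where
    tail-unique : ∀ {z : ℕ} {zs} → Unique (z ∷ zs) → Unique zs
    tail-unique (_ ∷ q) = q
  n1 : ∀ {x} → x ∈ concat R → x ≢ 1
  n1 mx e = head∉tail u (there (subst (_∈ _) e mx))
  d1 : ∀ {x} → x ∈ concat R → punchOut i x ≢ 1
  d1 {x} mx e = n1 mx (trans (sym (punchIn-punchOut i x (≢i mx))) (trans (cong (punchIn i) e) (punchIn-< 2≤i)))
  di1 : punchOut i 1 ≡ 1
  di1 = punchOut-≤ (≤-trans (s≤s z≤n) 2≤i)
  L1 : Arrangement (suc (suc m)) (1 ∷ map (punchOut i) (concat R))
  L1 = subst (λ z → Arrangement (suc (suc m)) (z ∷ map (punchOut i) (concat R))) di1 (arrangement-punchOut (arrangement-swap arrangement))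
  arrangement′ : Arrangement (suc m) (concat (dropFirstCycle i B0))
  arrangement′ = subst (Arrangement (suc m)) (trans (sym (map-∘ (concat R))) (sym (concat-map {f = (squeeze₂ i)} R))) (arrangement-punchOut L1)
  mono : ∀ {x y} → x ∈ concat R → y ∈ concat R → x < y → squeeze₂ i x < squeeze₂ i y
  mono mx my lt = punchOut-mono-< 1 (punchOut-mono-< i lt (≢i mx) (≢i my)) (d1 mx) (d1 my)
  standard′ : Standard (dropFirstCycle i B0)
  standard′ = standard-map (squeeze₂ i) R hmR mono
  nontrivial′ : nontrivialᵇ (dropFirstCycle i B0) ≡ true
  nontrivial′ = trans (nontrivialᵇ-map (squeeze₂ i) R) (∧-conicalʳ (2 ≤ᵇ 2) _ (qualifies-nontrivial (_≡ᵇ i) (_≡ᵇ k) B0 p))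
  avoids′ : avoids31-2 (concat (dropFirstCycle i B0)) ≡ true
  avoids′ = trans (cong avoids31-2 (concat-map {f = (squeeze₂ i)} R))
          (trans (avoids31-2-map (squeeze₂ i) (concat R) (λ mx my → <ᵇ-preserved (squeeze₂ i) (mono mx my) (mono my mx)))
            (avoids31-2-tail i (concat R) (avoids31-2-tail 1 (i ∷ concat R) (qualifies-avoids (_≡ᵇ i) (_≡ᵇ k) B0 p))))
  cycles′ : (suc (length (dropFirstCycle i B0)) ≡ᵇ k) ≡ true
  cycles′ = trans (cong (λ z → suc z ≡ᵇ k) (length-map (map (squeeze₂ i)) R)) (qualifies-cycles (_≡ᵇ i) (_≡ᵇ k) B0 p)
  inverse : addFirstCycle i (dropFirstCycle i B0) ≡ B0
  inverse = cong (_ ∷_) (map-map-inverse (spread₂ i) (squeeze₂ i) R (λ {x} mx → trans (cong (punchIn i) (punchIn-punchOut 1 (punchOut i x) (d1 mx))) (punchIn-punchOut i x (≢i mx))))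

spread₂->1 : ∀ i {x} → 1 ≤ x → 1 < spread₂ i x
spread₂->1 i {x} 1≤x = ≤-trans (s≤s 1≤x) (≤-trans (≤-reflexive (sym (punchIn-≥ 1≤x))) (punchIn-≥-self i (punchIn 1 x)))

addFirstCycle-standard : ∀ {n i B} → 2 ≤ i → CycleForm n B → Standard (addFirstCycle i B)
addFirstCycle-standard {n} {i} {B} 2≤i ((_ , sub , _) , std) =
  std∷ (2≤i ∷ []) (All.tabulate above1) (standard-map (spread₂ i) B std (λ _ _ lt → punchIn-mono-< i (punchIn-mono-< 1 lt)))
  where
  above1 : ∀ {b} → b ∈ map (map (spread₂ i)) B → All (1 <_) b
  above1 b∈ with ∈-map⁻ (map (spread₂ i)) b∈
  ... | b , b∈B , refl = All.tabulate λ z∈ →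
    let (x , x∈b , z≡) = ∈-map⁻ (spread₂ i) z∈ in subst (1 <_) (sym z≡) (spread₂->1 i (range1-≥1 (sub (∈-concat⁺′ x∈b b∈B))))

addFirstCycle-transfer : ∀ i m k B → 2 ≤ i → i ≤ 3 → CycleForm m B → secondFromWithExtraCycle 2 k B ≡ true →
  CycleForm (suc (suc m)) (addFirstCycle i B) × secondIs i k (addFirstCycle i B) ≡ true × (3 ≤ᵇ firstCycleLength (addFirstCycle i B)) ≡ false × dropFirstCycle i (addFirstCycle i B) ≡ B
addFirstCycle-transfer i zero k B 2≤i i≤3 v q with () ← ≤-trans (≤ᵇ-true⇒≤ (qualifies-second (2 ≤ᵇ_) (λ l → suc l ≡ᵇ k) B q)) (second-≤ v)
addFirstCycle-transfer i (suc m) k B 2≤i i≤3 v q with firstCycle-shape v (qualifies-nontrivial (2 ≤ᵇ_) (λ l → suc l ≡ᵇ k) B q)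
addFirstCycle-transfer i (suc m) k B 2≤i i≤3 v@((u , s , cv) , hm) q | c , r , R , refl = (arrangement′ , addFirstCycle-standard 2≤i v) , cong₂ _∧_ nontrivial′ (cong₂ _∧_ avoids′ (cong₂ _∧_ (≡ᵇ-refl i) cycles′)) , refl , inverse
  where
  B0 = (1 ∷ c ∷ r) ∷ R
  rest = r ++ concat R
  arrangement : Arrangement (suc m) (1 ∷ c ∷ rest)
  arrangement = u , s , cv
  i1 : punchIn i 1 ≡ 1
  i1 = punchIn-< 2≤i
  ceq : concat (addFirstCycle i B0) ≡ 1 ∷ i ∷ map (spread₂ i) (1 ∷ c ∷ rest)
  ceq = cong (λ L → 1 ∷ i ∷ L) (concat-map {f = (spread₂ i)} B0)
  L2 : Arrangement (suc (suc (suc m))) (i ∷ punchIn i 1 ∷ map (punchIn i) (map (punchIn 1) (1 ∷ c ∷ rest)))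
  L2 = arrangement-punchIn (arrangement-punchIn {i = 1} arrangement ≤-refl (s≤s z≤n)) (≤-trans (s≤s z≤n) 2≤i) (≤-trans i≤3 (s≤s (s≤s (s≤s z≤n))))
  arrangement′ : Arrangement (suc (suc (suc m))) (concat (addFirstCycle i B0))
  arrangement′ = subst (Arrangement (suc (suc (suc m)))) (sym ceq)
         (subst (λ z → Arrangement (suc (suc (suc m))) (1 ∷ i ∷ z)) (sym (map-∘ (1 ∷ c ∷ rest)))
           (arrangement-swap (subst (λ z → Arrangement (suc (suc (suc m))) (i ∷ z ∷ map (punchIn i) (map (punchIn 1) (1 ∷ c ∷ rest)))) i1 L2)))
  nontrivial′ : nontrivialᵇ (addFirstCycle i B0) ≡ true
  nontrivial′ = trans (nontrivialᵇ-map (spread₂ i) B0) (qualifies-nontrivial (2 ≤ᵇ_) (λ l → suc l ≡ᵇ k) B0 q)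
  avoids′ : avoids31-2 (concat (addFirstCycle i B0)) ≡ true
  avoids′ = trans (cong avoids31-2 ceq)
          (trans (avoids31-2-after1 i (map (spread₂ i) (1 ∷ c ∷ rest)))
            (cong₂ _∧_ (false⇒not-true (any-false⁺ _ (map (spread₂ i) (c ∷ rest)) (λ {z} _ → nothingBetween (spread₂ i 1) z i tb)))
                 (trans (avoids31-2-map (spread₂ i) (1 ∷ c ∷ rest) (λ {x} {y} _ _ → <ᵇ-preserved (spread₂ i) {x} {y} (λ lt → punchIn-mono-< i (punchIn-mono-< 1 lt)) (λ lt → punchIn-mono-< i (punchIn-mono-< 1 lt))))
                        (qualifies-avoids (2 ≤ᵇ_) (λ l → suc l ≡ᵇ k) B0 q))))
    where
    tb : i ∸ 1 ≤ spread₂ i 1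
    tb = ≤-trans (∸-monoˡ-≤ 1 i≤3) (punchIn-≥-self i 2)
  cycles′ : (length (addFirstCycle i B0) ≡ᵇ k) ≡ true
  cycles′ = trans (cong (λ z → suc z ≡ᵇ k) (length-map (map (spread₂ i)) B0)) (qualifies-cycles (2 ≤ᵇ_) (λ l → suc l ≡ᵇ k) B0 q)
  inverse : dropFirstCycle i (addFirstCycle i B0) ≡ B0
  inverse = map-map-inverse (squeeze₂ i) (spread₂ i) B0 (λ {x} _ → squeeze₂-spread₂ i x)

-- Recurrences

aTail : ℕ → ℕ → ℕ → ℕ
aTail m a k = count (λ w → isDerangement w ∧ avoids31-2 (flat w) ∧ (a ≤ᵇ secondLetter w) ∧ (μ w ≡ᵇ k)) (perms m)

count-byQualifies : ∀ n (second? cycles? : ℕ → Bool) →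
  count (λ w → isDerangement w ∧ avoids31-2 (flat w) ∧ second? (secondLetter w) ∧ cycles? (μ w)) (perms n)
    ≡ count (Qualifies second? cycles? ∘ cycles) (perms n)
count-byQualifies n second? cycles? = count-cong _ _ (perms n) λ {w} w∈ →
  cong₂ _∧_ (isDerangement≡nontrivialᵇ n w w∈) (cong (λ l → avoids31-2 (flat w) ∧ second? (secondLetter w) ∧ cycles? l) (μ≡length-cycles w))

secondLetter-≤ : ∀ {m w} → w ∈ perms m → secondLetter w ≤ m
secondLetter-≤ {m} {w} w∈ = second-≤ (proj₁ (cycles-valid m w w∈))

∧-false³ : ∀ x y z → x ∧ y ∧ z ∧ false ≡ false
∧-false³ x y z = trans (cong (λ t → x ∧ y ∧ t) (∧-zeroʳ z)) (trans (cong (x ∧_) (∧-zeroʳ y)) (∧-zeroʳ x))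

count-secondLetter-none : ∀ m (second? cycles? : ℕ → Bool) → (∀ {s} → s ≤ m → second? s ≡ false) →
  count (λ w → isDerangement w ∧ avoids31-2 (flat w) ∧ second? (secondLetter w) ∧ cycles? (μ w)) (perms m) ≡ 0
count-secondLetter-none m second? cycles? none = count-none _ (perms m) λ {w} w∈ →
  trans (cong (λ b → isDerangement w ∧ avoids31-2 (flat w) ∧ b) (cong (_∧ cycles? (μ w)) (none (secondLetter-≤ w∈))))
        (trans (cong (λ b → isDerangement w ∧ b) (∧-zeroʳ (avoids31-2 (flat w)))) (∧-zeroʳ (isDerangement w)))

aCoeff-beyond : ∀ m i k → m < i → aCoeff m i k ≡ 0
aCoeff-beyond m i k m<i = count-secondLetter-none m (_≡ᵇ i) (_≡ᵇ k) λ {s} s≤m → ≢⇒≡ᵇ-false {s} {i} λ { refl → <⇒≱ m<i s≤m }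

aTail-beyond : ∀ m a k → m < a → aTail m a k ≡ 0
aTail-beyond m a k m<a = count-secondLetter-none m (a ≤ᵇ_) (_≡ᵇ k) λ s≤m → >⇒≤ᵇ-false (≤-<-trans s≤m m<a)

≤ᵇ-split : ∀ a s → (a ≤ᵇ s) ≡ (s ≡ᵇ a) ∨ (suc a ≤ᵇ s)
≤ᵇ-split zero zero = refl
≤ᵇ-split zero (suc s) = refl
≤ᵇ-split (suc a) zero = refl
≤ᵇ-split (suc zero) (suc s) = ≤ᵇ-split zero s
≤ᵇ-split (suc (suc a)) (suc s) = ≤ᵇ-split (suc a) s

∧-distrib-middle : ∀ x y p q z → x ∧ y ∧ (p ∨ q) ∧ z ≡ (x ∧ y ∧ p ∧ z) ∨ (x ∧ y ∧ q ∧ z)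
∧-distrib-middle x y p q z =
  trans (cong (λ t → x ∧ y ∧ t) (∧-distribʳ-∨ z p q)) (trans (cong (x ∧_) (∧-distribˡ-∨ y _ _)) (∧-distribˡ-∨ x _ _))

∧-exclusive-middle : ∀ x y p q z → (p ≡ true → q ≡ false) → x ∧ y ∧ p ∧ z ≡ true → x ∧ y ∧ q ∧ z ≡ false
∧-exclusive-middle true true true q z p⇒¬q _ rewrite p⇒¬q refl = refl

aTail-split : ∀ m a k → aTail m a k ≡ aCoeff m a k + aTail m (suc a) k
aTail-split m a k =
  trans (count-cong _ (λ w → withSecond w (secondLetter w ≡ᵇ a) ∨ withSecond w (suc a ≤ᵇ secondLetter w)) (perms m) split)
        (count-∨ (λ w → withSecond w (secondLetter w ≡ᵇ a)) (λ w → withSecond w (suc a ≤ᵇ secondLetter w)) (perms m) exclusive)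
  where
  withSecond : List ℕ → Bool → Bool
  withSecond w b = isDerangement w ∧ avoids31-2 (flat w) ∧ b ∧ (μ w ≡ᵇ k)
  split : ∀ {w} → w ∈ perms m → withSecond w (a ≤ᵇ secondLetter w) ≡ withSecond w (secondLetter w ≡ᵇ a) ∨ withSecond w (suc a ≤ᵇ secondLetter w)
  split {w} _ = trans (cong (withSecond w) (≤ᵇ-split a (secondLetter w)))
                      (∧-distrib-middle (isDerangement w) (avoids31-2 (flat w)) (secondLetter w ≡ᵇ a) (suc a ≤ᵇ secondLetter w) (μ w ≡ᵇ k))
  exclusive : ∀ {w} → w ∈ perms m → withSecond w (secondLetter w ≡ᵇ a) ≡ true → withSecond w (suc a ≤ᵇ secondLetter w) ≡ false
  exclusive {w} _ = ∧-exclusive-middle (isDerangement w) (avoids31-2 (flat w)) _ _ (μ w ≡ᵇ k) λ s≡a →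
    subst (λ s → (suc a ≤ᵇ s) ≡ false) (sym (≡ᵇ-true⇒≡ {secondLetter w} {a} s≡a)) (>⇒≤ᵇ-false (n<1+n a))

minSecondAfterDeletion-≥4 : ∀ {i} → 4 ≤ i → minSecondAfterDeletion i ≡ pred i
minSecondAfterDeletion-≥4 (s≤s (s≤s (s≤s (s≤s _)))) = refl

aCoeff-≥4 : ∀ m i k → 4 ≤ i → aCoeff (suc m) i k ≡ aTail m (pred i) k
aCoeff-≥4 m i k 4≤i = begin
  aCoeff (suc m) i k                               ≡⟨ count-byQualifies (suc m) (_≡ᵇ i) (_≡ᵇ k) ⟩
  count (secondIs i k ∘ cycles) (perms (suc m))    ≡⟨ count-byCycles (suc m) m _ _ (deleteSecond i) (insertSecond i) delete insert ⟩
  count (secondFrom (pred i) k ∘ cycles) (perms m) ≡⟨ count-byQualifies m (pred i ≤ᵇ_) (_≡ᵇ k) ⟨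
  aTail m (pred i) k                               ∎
  where
  open ≡-Reasoning
  2≤i : 2 ≤ i
  2≤i = ≤-trans (s≤s (s≤s z≤n)) 4≤i
  lowerBound≡pred : minSecondAfterDeletion i ≡ pred i
  lowerBound≡pred = minSecondAfterDeletion-≥4 4≤i
  delete : Transfer (suc m) m (secondIs i k) (secondFrom (pred i) k) (deleteSecond i) (insertSecond i)
  delete B form q =
    let (form′ , q′ , inverse) = deleteSecond-transfer i m k B 2≤i form q (firstCycle-long i m k B 4≤i form q)
    in form′ , subst (λ a → secondFrom a k (deleteSecond i B) ≡ true) lowerBound≡pred q′ , inverse
  insert : Transfer m (suc m) (secondFrom (pred i) k) (secondIs i k) (insertSecond i) (deleteSecond i)
  insert B form q =
    let (form′ , q′ , _ , inverse) = insertSecond-transfer i m k B 2≤i form (subst (λ a → secondFrom a k B ≡ true) (sym lowerBound≡pred) q)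
    in form′ , q′ , inverse

minSecondAfterDeletion-≤3 : ∀ {i} → i ≤ 3 → minSecondAfterDeletion i ≡ 2
minSecondAfterDeletion-≤3 {0} _ = refl
minSecondAfterDeletion-≤3 {1} _ = refl
minSecondAfterDeletion-≤3 {2} _ = refl
minSecondAfterDeletion-≤3 {3} _ = refl
minSecondAfterDeletion-≤3 {suc (suc (suc (suc _)))} (s≤s (s≤s (s≤s ())))

longFirstCycle : List (List ℕ) → Bool
longFirstCycle B = 3 ≤ᵇ firstCycleLength B

aCoeff-2or3 : ∀ m i k → 2 ≤ i → i ≤ 3 →
  aCoeff (3 + m) i k ≡ aTail (2 + m) 2 k + count (secondFromWithExtraCycle 2 k ∘ cycles) (perms (1 + m))
aCoeff-2or3 m i k 2≤i i≤3 = begin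
  aCoeff (3 + m) i k                                            ≡⟨ count-byQualifies (3 + m) (_≡ᵇ i) (_≡ᵇ k) ⟩
  count (secondIs i k ∘ cycles) (perms (3 + m))                 ≡⟨ count-cong _ _ (perms (3 + m)) (λ {w} _ → split (secondIs i k (cycles w)) (longFirstCycle (cycles w))) ⟩
  count (λ w → long (cycles w) ∨ short (cycles w)) (perms (3 + m)) ≡⟨ count-∨ (long ∘ cycles) (short ∘ cycles) (perms (3 + m)) (λ {w} _ → exclusive (secondIs i k (cycles w)) _) ⟩
  count (long ∘ cycles) (perms (3 + m)) + count (short ∘ cycles) (perms (3 + m))
    ≡⟨ cong₂ _+_ (count-byCycles (3 + m) (2 + m) long (secondFrom 2 k) (deleteSecond i) (insertSecond i) delete insert)
                 (count-byCycles (3 + m) (1 + m) short (secondFromWithExtraCycle 2 k) (dropFirstCycle i) (addFirstCycle i) drop add) ⟩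
  count (secondFrom 2 k ∘ cycles) (perms (2 + m)) + count (secondFromWithExtraCycle 2 k ∘ cycles) (perms (1 + m))
    ≡⟨ cong (_+ count (secondFromWithExtraCycle 2 k ∘ cycles) (perms (1 + m))) (count-byQualifies (2 + m) (2 ≤ᵇ_) (_≡ᵇ k)) ⟨
  aTail (2 + m) 2 k + count (secondFromWithExtraCycle 2 k ∘ cycles) (perms (1 + m)) ∎
  where
  open ≡-Reasoning
  long short : List (List ℕ) → Bool
  long B = secondIs i k B ∧ longFirstCycle B
  short B = secondIs i k B ∧ not (longFirstCycle B)
  split : ∀ a c → a ≡ (a ∧ c) ∨ (a ∧ not c)
  split false c = refl
  split true true = refl
  split true false = refl
  exclusive : ∀ a c → (a ∧ c) ≡ true → (a ∧ not c) ≡ false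
  exclusive true true _ = refl
  lowerBound≡2 : minSecondAfterDeletion i ≡ 2
  lowerBound≡2 = minSecondAfterDeletion-≤3 i≤3
  delete : Transfer (3 + m) (2 + m) long (secondFrom 2 k) (deleteSecond i) (insertSecond i)
  delete B form q =
    let (form′ , q′ , inverse) = deleteSecond-transfer i (2 + m) k B 2≤i form (∧-conicalˡ _ _ q) (≤ᵇ-true⇒≤ (∧-conicalʳ (secondIs i k B) _ q))
    in form′ , subst (λ a → secondFrom a k (deleteSecond i B) ≡ true) lowerBound≡2 q′ , inverse
  insert : Transfer (2 + m) (3 + m) (secondFrom 2 k) long (insertSecond i) (deleteSecond i)
  insert B form q =
    let (form′ , q′ , isLong , inverse) = insertSecond-transfer i (2 + m) k B 2≤i form (subst (λ a → secondFrom a k B ≡ true) (sym lowerBound≡2) q)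
    in form′ , cong₂ _∧_ q′ (≤⇒≤ᵇ-true isLong) , inverse
  drop : Transfer (3 + m) (1 + m) short (secondFromWithExtraCycle 2 k) (dropFirstCycle i) (addFirstCycle i)
  drop B form q = dropFirstCycle-transfer i m k B 2≤i i≤3 form (∧-conicalˡ _ _ q) (not-true⇒false (∧-conicalʳ (secondIs i k B) _ q))
  add : Transfer (1 + m) (3 + m) (secondFromWithExtraCycle 2 k) short (addFirstCycle i) (dropFirstCycle i)
  add B form q =
    let (form′ , q′ , isShort , inverse) = addFirstCycle-transfer i (1 + m) k B 2≤i i≤3 form q
    in form′ , cong₂ _∧_ q′ (false⇒not-true isShort) , inverse

count-extraCycle-zero : ∀ m → count (secondFromWithExtraCycle 2 0 ∘ cycles) (perms m) ≡ 0
count-extraCycle-zero m = count-none _ (perms m) λ {w} _ →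
  ∧-false³ (nontrivialᵇ (cycles w)) (avoids31-2 (flat w)) (2 ≤ᵇ secondLetter w)

aCoeff-2or3-zero : ∀ m i → 2 ≤ i → i ≤ 3 → aCoeff (3 + m) i 0 ≡ aTail (2 + m) 2 0
aCoeff-2or3-zero m i 2≤i i≤3 = trans (aCoeff-2or3 m i 0 2≤i i≤3) (trans (cong (λ x → aTail (2 + m) 2 0 + x) (count-extraCycle-zero (1 + m))) (+-identityʳ _))

aCoeff-2or3-suc : ∀ m i k → 2 ≤ i → i ≤ 3 → aCoeff (3 + m) i (suc k) ≡ aTail (2 + m) 2 (suc k) + aTail (1 + m) 2 k
aCoeff-2or3-suc m i k 2≤i i≤3 = trans (aCoeff-2or3 m i (suc k) 2≤i i≤3) (cong (λ x → aTail (2 + m) 2 (suc k) + x) (sym (count-byQualifies (1 + m) (2 ≤ᵇ_) (_≡ᵇ k))))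

-- Formal power series

Σ-zero : ∀ f → Σ≤ 0 f ≡ f 0
Σ-zero f = ℤ.+-identityʳ (f 0)

Σ-suc : ∀ n f → Σ≤ (suc n) f ≡ f 0 +ℤ Σ≤ n (f ∘ suc)
Σ-suc n f = cong (λ xs → f 0 +ℤ foldr _+ℤ_ (+ 0) xs) (trans (map-applyUpTo suc f (suc n)) (sym (map-upTo (f ∘ suc) (suc n))))

Σ-cong : ∀ n {f g} → (∀ t → f t ≡ g t) → Σ≤ n f ≡ Σ≤ n g
Σ-cong n f≗g = cong (foldr _+ℤ_ (+ 0)) (map-cong f≗g (upTo (suc n)))

Σ-zeros : ∀ n f → (∀ t → f t ≡ + 0) → Σ≤ n f ≡ + 0
Σ-zeros zero f f≗0 = trans (Σ-zero f) (f≗0 0)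
Σ-zeros (suc n) f f≗0 = trans (Σ-suc n f) (cong₂ _+ℤ_ (f≗0 0) (Σ-zeros n (f ∘ suc) (f≗0 ∘ suc)))

Σ-+ : ∀ n f g → Σ≤ n (λ t → f t +ℤ g t) ≡ Σ≤ n f +ℤ Σ≤ n g
Σ-+ zero f g = trans (Σ-zero (λ t → f t +ℤ g t)) (sym (cong₂ _+ℤ_ (Σ-zero f) (Σ-zero g)))
Σ-+ (suc n) f g = begin
  Σ≤ (suc n) (λ t → f t +ℤ g t)                          ≡⟨ Σ-suc n (λ t → f t +ℤ g t) ⟩
  (f 0 +ℤ g 0) +ℤ Σ≤ n (λ t → f (suc t) +ℤ g (suc t))    ≡⟨ cong ((f 0 +ℤ g 0) +ℤ_) (Σ-+ n (f ∘ suc) (g ∘ suc)) ⟩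
  (f 0 +ℤ g 0) +ℤ (Σ≤ n (f ∘ suc) +ℤ Σ≤ n (g ∘ suc))     ≡⟨ ℤ-interchange (f 0) (g 0) _ _ ⟩
  (f 0 +ℤ Σ≤ n (f ∘ suc)) +ℤ (g 0 +ℤ Σ≤ n (g ∘ suc))     ≡⟨ cong₂ _+ℤ_ (Σ-suc n f) (Σ-suc n g) ⟨
  Σ≤ (suc n) f +ℤ Σ≤ (suc n) g                           ∎
  where open ≡-Reasoning

Σ-neg : ∀ n f → Σ≤ n (λ t → -ℤ f t) ≡ -ℤ Σ≤ n f
Σ-neg zero f = trans (Σ-zero (λ t → -ℤ f t)) (cong -ℤ_ (sym (Σ-zero f)))
Σ-neg (suc n) f = trans (Σ-suc n (λ t → -ℤ f t)) (trans (cong (-ℤ f 0 +ℤ_) (Σ-neg n (f ∘ suc)))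
                    (trans (sym (ℤ.neg-distrib-+ (f 0) _)) (cong -ℤ_ (sym (Σ-suc n f)))))

Σ-delta : ∀ n a f → (∀ t → t ≢ a → f t ≡ + 0) → Σ≤ n f ≡ (if a ≤ᵇ n then f a else + 0)
Σ-delta zero zero f f≗0 = Σ-zero f
Σ-delta zero (suc a) f f≗0 = trans (Σ-zero f) (f≗0 0 λ ())
Σ-delta (suc n) zero f f≗0 = trans (Σ-suc n f) (trans (cong (f 0 +ℤ_) (Σ-zeros n (f ∘ suc) (λ t → f≗0 (suc t) λ ()))) (ℤ.+-identityʳ (f 0)))
Σ-delta (suc n) (suc a) f f≗0 = trans (Σ-suc n f) (trans (cong₂ _+ℤ_ (f≗0 0 λ ()) (Σ-delta n a (f ∘ suc) (λ t t≢a → f≗0 (suc t) (t≢a ∘ suc-injective))))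
  (trans (ℤ.+-identityˡ _) (cong (λ b → if b then f (suc a) else + 0) (sym (≤ᵇ-suc a n)))))
  where
  ≤ᵇ-suc : ∀ a n → (suc a ≤ᵇ suc n) ≡ (a ≤ᵇ n)
  ≤ᵇ-suc zero n = refl
  ≤ᵇ-suc (suc a) n = refl

Σ³ : ℕ → ℕ → ℕ → (ℕ → ℕ → ℕ → ℤ) → ℤ
Σ³ n j k h = Σ≤ n λ a → Σ≤ j λ b → Σ≤ k λ c → h a b c

Σ³-cong : ∀ n j k {f g : ℕ → ℕ → ℕ → ℤ} → (∀ a b c → f a b c ≡ g a b c) → Σ³ n j k f ≡ Σ³ n j k g
Σ³-cong n j k f≗g = Σ-cong n λ a → Σ-cong j λ b → Σ-cong k λ c → f≗g a b c

Σ³-+ : ∀ n j k f g → Σ³ n j k (λ a b c → f a b c +ℤ g a b c) ≡ Σ³ n j k f +ℤ Σ³ n j k g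
Σ³-+ n j k f g =
  trans (Σ-cong n λ a → trans (Σ-cong j λ b → Σ-+ k (f a b) (g a b)) (Σ-+ j (λ b → Σ≤ k (f a b)) (λ b → Σ≤ k (g a b))))
        (Σ-+ n (λ a → Σ≤ j λ b → Σ≤ k (f a b)) (λ a → Σ≤ j λ b → Σ≤ k (g a b)))

Σ³-neg : ∀ n j k f → Σ³ n j k (λ a b c → -ℤ f a b c) ≡ -ℤ Σ³ n j k f
Σ³-neg n j k f =
  trans (Σ-cong n λ a → trans (Σ-cong j λ b → Σ-neg k (f a b)) (Σ-neg j (λ b → Σ≤ k (f a b))))
        (Σ-neg n (λ a → Σ≤ j λ b → Σ≤ k (f a b)))

infix 4 _≋_
_≋_ : Series → Series → Set
F ≋ G = ∀ n j k → F n j k ≡ G n j k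

monomial : ℕ → ℕ → ℕ → Series
monomial a b c n j k = if (n ≡ᵇ a) ∧ (j ≡ᵇ b) ∧ (k ≡ᵇ c) then + 1 else + 0

shift : ℕ → ℕ → ℕ → Series → Series
shift a b c G n j k = if (a ≤ᵇ n) ∧ (b ≤ᵇ j) ∧ (c ≤ᵇ k) then G (n ∸ a) (j ∸ b) (k ∸ c) else + 0

⊛-congˡ : ∀ {F F′} G → F ≋ F′ → F ⊛ G ≋ F′ ⊛ G
⊛-congˡ G F≋F′ n j k = Σ³-cong n j k λ a b c → cong (_*ℤ G (n ∸ a) (j ∸ b) (k ∸ c)) (F≋F′ a b c)

⊛-distribʳ-⊕ : ∀ F F′ G → (F ⊕ F′) ⊛ G ≋ F ⊛ G ⊕ F′ ⊛ G
⊛-distribʳ-⊕ F F′ G n j k =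
  trans (Σ³-cong n j k λ a b c → ℤ.*-distribʳ-+ (G (n ∸ a) (j ∸ b) (k ∸ c)) (F a b c) (F′ a b c))
        (Σ³-+ n j k (λ a b c → F a b c *ℤ G (n ∸ a) (j ∸ b) (k ∸ c)) (λ a b c → F′ a b c *ℤ G (n ∸ a) (j ∸ b) (k ∸ c)))

⊛-distribʳ-⊟ : ∀ F F′ G → (F ⊟ F′) ⊛ G ≋ F ⊛ G ⊟ F′ ⊛ G
⊛-distribʳ-⊟ F F′ G n j k =
  trans (⊛-distribʳ-⊕ F (λ a b c → -ℤ F′ a b c) G n j k) (cong ((F ⊛ G) n j k +ℤ_)
    (trans (Σ³-cong n j k λ a b c → sym (ℤ.neg-distribˡ-* (F′ a b c) (G (n ∸ a) (j ∸ b) (k ∸ c))))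
           (Σ³-neg n j k λ a b c → F′ a b c *ℤ G (n ∸ a) (j ∸ b) (k ∸ c))))

if-∧ : ∀ p q (x : ℤ) → (if p then (if q then x else + 0) else + 0) ≡ (if p ∧ q then x else + 0)
if-∧ false q x = refl
if-∧ true q x = refl

monomial-⊛ : ∀ a₀ b₀ c₀ G → monomial a₀ b₀ c₀ ⊛ G ≋ shift a₀ b₀ c₀ G
monomial-⊛ a₀ b₀ c₀ G n j k = begin
  (monomial a₀ b₀ c₀ ⊛ G) n j k
    ≡⟨ Σ-delta n a₀ _ (λ a a≢ → Σ-zeros j _ λ b → Σ-zeros k _ λ c → vanish a b c (inj₁ a≢)) ⟩
  (if a₀ ≤ᵇ n then Σ≤ j (λ b → Σ≤ k λ c → term a₀ b c) else + 0)
    ≡⟨ cong (λ s → if a₀ ≤ᵇ n then s else + 0) (Σ-delta j b₀ _ λ b b≢ → Σ-zeros k _ λ c → vanish a₀ b c (inj₂ (inj₁ b≢))) ⟩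
  (if a₀ ≤ᵇ n then (if b₀ ≤ᵇ j then Σ≤ k (term a₀ b₀) else + 0) else + 0)
    ≡⟨ cong (λ s → if a₀ ≤ᵇ n then (if b₀ ≤ᵇ j then s else + 0) else + 0) (Σ-delta k c₀ _ λ c c≢ → vanish a₀ b₀ c (inj₂ (inj₂ c≢))) ⟩
  (if a₀ ≤ᵇ n then (if b₀ ≤ᵇ j then (if c₀ ≤ᵇ k then term a₀ b₀ c₀ else + 0) else + 0) else + 0)
    ≡⟨ cong (λ s → if a₀ ≤ᵇ n then s else + 0) (if-∧ (b₀ ≤ᵇ j) (c₀ ≤ᵇ k) _) ⟩
  (if a₀ ≤ᵇ n then (if (b₀ ≤ᵇ j) ∧ (c₀ ≤ᵇ k) then term a₀ b₀ c₀ else + 0) else + 0)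
    ≡⟨ if-∧ (a₀ ≤ᵇ n) _ _ ⟩
  (if (a₀ ≤ᵇ n) ∧ (b₀ ≤ᵇ j) ∧ (c₀ ≤ᵇ k) then term a₀ b₀ c₀ else + 0)
    ≡⟨ cong (λ s → if (a₀ ≤ᵇ n) ∧ (b₀ ≤ᵇ j) ∧ (c₀ ≤ᵇ k) then s else + 0) unit ⟩
  shift a₀ b₀ c₀ G n j k ∎
  where
  open ≡-Reasoning
  term : ℕ → ℕ → ℕ → ℤ
  term a b c = monomial a₀ b₀ c₀ a b c *ℤ G (n ∸ a) (j ∸ b) (k ∸ c)
  vanish : ∀ a b c → a ≢ a₀ ⊎ b ≢ b₀ ⊎ c ≢ c₀ → term a b c ≡ + 0
  vanish a b c (inj₁ a≢) rewrite ≢⇒≡ᵇ-false a≢ = refl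
  vanish a b c (inj₂ (inj₁ b≢)) rewrite ≢⇒≡ᵇ-false b≢ | ∧-zeroʳ (a ≡ᵇ a₀) = refl
  vanish a b c (inj₂ (inj₂ c≢)) rewrite ≢⇒≡ᵇ-false c≢ | ∧-zeroʳ (b ≡ᵇ b₀) | ∧-zeroʳ (a ≡ᵇ a₀) = refl
  unit : term a₀ b₀ c₀ ≡ G (n ∸ a₀) (j ∸ b₀) (k ∸ c₀)
  unit rewrite ≡ᵇ-refl a₀ | ≡ᵇ-refl b₀ | ≡ᵇ-refl c₀ = ℤ.*-identityˡ _

≤ᵇ∧∸≡ᵇ : ∀ a a′ n → (a ≤ᵇ n) ∧ (n ∸ a ≡ᵇ a′) ≡ (n ≡ᵇ a + a′)
≤ᵇ∧∸≡ᵇ zero a′ n = refl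
≤ᵇ∧∸≡ᵇ (suc a) a′ zero = refl
≤ᵇ∧∸≡ᵇ (suc zero) a′ (suc n) = ≤ᵇ∧∸≡ᵇ zero a′ n
≤ᵇ∧∸≡ᵇ (suc (suc a)) a′ (suc n) = ≤ᵇ∧∸≡ᵇ (suc a) a′ n

shift-monomial : ∀ a b c a′ b′ c′ → shift a b c (monomial a′ b′ c′) ≋ monomial (a + a′) (b + b′) (c + c′)
shift-monomial a b c a′ b′ c′ n j k =
  trans (if-∧ ((a ≤ᵇ n) ∧ (b ≤ᵇ j) ∧ (c ≤ᵇ k)) ((n ∸ a ≡ᵇ a′) ∧ (j ∸ b ≡ᵇ b′) ∧ (k ∸ c ≡ᵇ c′)) (+ 1))
        (cong (λ p → if p then + 1 else + 0) (begin
          ((a ≤ᵇ n) ∧ (b ≤ᵇ j) ∧ (c ≤ᵇ k)) ∧ ((n ∸ a ≡ᵇ a′) ∧ (j ∸ b ≡ᵇ b′) ∧ (k ∸ c ≡ᵇ c′))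
            ≡⟨ ∧-interchange (a ≤ᵇ n) _ _ _ ⟩
          ((a ≤ᵇ n) ∧ (n ∸ a ≡ᵇ a′)) ∧ (((b ≤ᵇ j) ∧ (c ≤ᵇ k)) ∧ ((j ∸ b ≡ᵇ b′) ∧ (k ∸ c ≡ᵇ c′)))
            ≡⟨ cong (((a ≤ᵇ n) ∧ (n ∸ a ≡ᵇ a′)) ∧_) (∧-interchange (b ≤ᵇ j) _ _ _) ⟩
          ((a ≤ᵇ n) ∧ (n ∸ a ≡ᵇ a′)) ∧ ((b ≤ᵇ j) ∧ (j ∸ b ≡ᵇ b′)) ∧ ((c ≤ᵇ k) ∧ (k ∸ c ≡ᵇ c′))
            ≡⟨ cong₂ _∧_ (≤ᵇ∧∸≡ᵇ a a′ n) (cong₂ _∧_ (≤ᵇ∧∸≡ᵇ b b′ j) (≤ᵇ∧∸≡ᵇ c c′ k)) ⟩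
          (n ≡ᵇ a + a′) ∧ (j ≡ᵇ b + b′) ∧ (k ≡ᵇ c + c′) ∎))
  where open ≡-Reasoning

shift-cong : ∀ a b c {F G} → F ≋ G → shift a b c F ≋ shift a b c G
shift-cong a b c F≋G n j k = cong (λ x → if (a ≤ᵇ n) ∧ (b ≤ᵇ j) ∧ (c ≤ᵇ k) then x else + 0) (F≋G (n ∸ a) (j ∸ b) (k ∸ c))

shift-⊕ : ∀ a b c F G → shift a b c (F ⊕ G) ≋ shift a b c F ⊕ shift a b c G
shift-⊕ a b c F G n j k with (a ≤ᵇ n) ∧ (b ≤ᵇ j) ∧ (c ≤ᵇ k)
... | true = refl
... | false = refl

shift-⊟ : ∀ a b c F G → shift a b c (F ⊟ G) ≋ shift a b c F ⊟ shift a b c G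
shift-⊟ a b c F G n j k with (a ≤ᵇ n) ∧ (b ≤ᵇ j) ∧ (c ≤ᵇ k)
... | true = refl
... | false = refl

monomial-⊛-monomial : ∀ {F G} a b c a′ b′ c′ → F ≋ monomial a b c → G ≋ monomial a′ b′ c′ → F ⊛ G ≋ monomial (a + a′) (b + b′) (c + c′)
monomial-⊛-monomial {F} {G} a b c a′ b′ c′ F≋ G≋ n j k =
  trans (⊛-congˡ G F≋ n j k) (trans (monomial-⊛ a b c G n j k) (trans (shift-cong a b c G≋ n j k) (shift-monomial a b c a′ b′ c′ n j k)))

𝟙≋monomial : 𝟙 ≋ monomial 0 0 0
𝟙≋monomial zero zero zero = refl
𝟙≋monomial zero zero (suc k) = refl
𝟙≋monomial zero (suc j) k = refl
𝟙≋monomial (suc n) j k = refl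

X≋monomial : X ≋ monomial 1 0 0
X≋monomial zero j k = refl
X≋monomial (suc zero) zero zero = refl
X≋monomial (suc zero) zero (suc k) = refl
X≋monomial (suc zero) (suc j) k = refl
X≋monomial (suc (suc n)) j k = refl

V≋monomial : V ≋ monomial 0 1 0
V≋monomial (suc n) j k = refl
V≋monomial zero zero k = refl
V≋monomial zero (suc zero) zero = refl
V≋monomial zero (suc zero) (suc k) = refl
V≋monomial zero (suc (suc j)) k = refl

Y≋monomial : Y ≋ monomial 0 0 1
Y≋monomial (suc n) j k = refl
Y≋monomial zero (suc j) k = refl
Y≋monomial zero zero zero = refl
Y≋monomial zero zero (suc zero) = refl
Y≋monomial zero zero (suc (suc k)) = refl

-- Comparing coefficients

telescope : ∀ (f T : ℕ → ℤ) → (∀ t → T t ≡ f t +ℤ T (suc t)) → ∀ N → Σ≤ N f +ℤ T (suc N) ≡ T 0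
telescope f T step zero = trans (cong (_+ℤ T 1) (Σ-zero f)) (sym (step 0))
telescope f T step (suc N) = begin
  Σ≤ (suc N) f +ℤ T (2 + N)                  ≡⟨ cong (_+ℤ T (2 + N)) (Σ-suc N f) ⟩
  (f 0 +ℤ Σ≤ N (f ∘ suc)) +ℤ T (2 + N)       ≡⟨ ℤ.+-assoc (f 0) _ _ ⟩
  f 0 +ℤ (Σ≤ N (f ∘ suc) +ℤ T (2 + N))       ≡⟨ cong (f 0 +ℤ_) (telescope (f ∘ suc) (T ∘ suc) (step ∘ suc) N) ⟩
  f 0 +ℤ T 1                                 ≡⟨ step 0 ⟨
  T 0                                        ∎
  where open ≡-Reasoning

A₁≡aTail : ∀ m k → A₁ m 0 k ≡ + aTail m 2 k
A₁≡aTail 0 k = refl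
A₁≡aTail 1 k = refl
A₁≡aTail m@(suc (suc _)) k = begin
  Σ≤ m (λ j → + aCoeff m (j + 2) k)                           ≡⟨ ℤ.+-identityʳ _ ⟨
  Σ≤ m (λ j → + aCoeff m (j + 2) k) +ℤ + 0                    ≡⟨ cong (λ t → Σ≤ m (λ j → + aCoeff m (j + 2) k) +ℤ + t) (aTail-beyond m (suc m + 2) k (m≤m+n (suc m) 2)) ⟨
  Σ≤ m (λ j → + aCoeff m (j + 2) k) +ℤ + aTail m (suc m + 2) k ≡⟨ telescope (λ j → + aCoeff m (j + 2) k) (λ t → + aTail m (t + 2) k) (λ t → cong +_ (aTail-split m (t + 2) k)) m ⟩
  + aTail m 2 k                                               ∎
  where open ≡-Reasoning

⊛-byMonomial : ∀ {F} a b c G → F ≋ monomial a b c → F ⊛ G ≋ shift a b c G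
⊛-byMonomial {F} a b c G F≋ n j k = trans (⊛-congˡ G F≋ n j k) (monomial-⊛ a b c G n j k)

XVV≋monomial : X ⊛ V ⊛ V ≋ monomial 1 2 0
XVV≋monomial = monomial-⊛-monomial 1 1 0 0 1 0 (monomial-⊛-monomial 1 0 0 0 1 0 X≋monomial V≋monomial) V≋monomial

XY≋monomial : X ⊛ Y ≋ monomial 1 0 1
XY≋monomial = monomial-⊛-monomial 1 0 0 0 0 1 X≋monomial Y≋monomial

XXY≋monomial : X ⊛ X ⊛ Y ≋ monomial 2 0 1
XXY≋monomial = monomial-⊛-monomial 2 0 0 0 0 1 (monomial-⊛-monomial 1 0 0 1 0 0 X≋monomial X≋monomial) Y≋monomial

XYVV≋monomial : X ⊛ Y ⊛ V ⊛ V ≋ monomial 1 2 1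
XYVV≋monomial = monomial-⊛-monomial 1 1 1 0 1 0 (monomial-⊛-monomial 1 0 1 0 1 0 XY≋monomial V≋monomial) V≋monomial

lhsShifts : Series
lhsShifts = A ⊟ shift 0 1 0 A ⊕ shift 1 2 0 A

rhsShifts : Series
rhsShifts = shift 2 0 1 (𝟙 ⊟ V) ⊕ (shift 1 0 0 A₁ ⊕ shift 2 0 1 A₁ ⊟ shift 2 2 1 A₁)

lhs≋lhsShifts : (𝟙 ⊟ V ⊕ X ⊛ V ⊛ V) ⊛ A ≋ lhsShifts
lhs≋lhsShifts n j k =
  trans (⊛-distribʳ-⊕ (𝟙 ⊟ V) (X ⊛ V ⊛ V) A n j k)
    (cong₂ _+ℤ_ (trans (⊛-distribʳ-⊟ 𝟙 V A n j k)
                       (cong₂ (λ a b → a +ℤ -ℤ b) (⊛-byMonomial 0 0 0 A 𝟙≋monomial n j k) (⊛-byMonomial 0 1 0 A V≋monomial n j k)))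
                (⊛-byMonomial 1 2 0 A XVV≋monomial n j k))

X⊛factor≋ : X ⊛ (𝟙 ⊕ X ⊛ Y ⊟ X ⊛ Y ⊛ V ⊛ V) ≋ monomial 1 0 0 ⊕ monomial 2 0 1 ⊟ monomial 2 2 1
X⊛factor≋ n j k = begin
  (X ⊛ (𝟙 ⊕ X ⊛ Y ⊟ X ⊛ Y ⊛ V ⊛ V)) n j k
    ≡⟨ ⊛-byMonomial 1 0 0 (𝟙 ⊕ X ⊛ Y ⊟ X ⊛ Y ⊛ V ⊛ V) X≋monomial n j k ⟩
  shift 1 0 0 (𝟙 ⊕ X ⊛ Y ⊟ X ⊛ Y ⊛ V ⊛ V) n j k
    ≡⟨ shift-⊟ 1 0 0 (𝟙 ⊕ X ⊛ Y) (X ⊛ Y ⊛ V ⊛ V) n j k ⟩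
  (shift 1 0 0 (𝟙 ⊕ X ⊛ Y) ⊟ shift 1 0 0 (X ⊛ Y ⊛ V ⊛ V)) n j k
    ≡⟨ cong₂ (λ a b → a +ℤ -ℤ b) (shift-⊕ 1 0 0 𝟙 (X ⊛ Y) n j k) refl ⟩
  (shift 1 0 0 𝟙 ⊕ shift 1 0 0 (X ⊛ Y) ⊟ shift 1 0 0 (X ⊛ Y ⊛ V ⊛ V)) n j k
    ≡⟨ cong₂ (λ a b → a +ℤ -ℤ b) (cong₂ _+ℤ_ (onMonomial 0 0 0 𝟙≋monomial) (onMonomial 1 0 1 XY≋monomial)) (onMonomial 1 2 1 XYVV≋monomial) ⟩
  (monomial 1 0 0 ⊕ monomial 2 0 1 ⊟ monomial 2 2 1) n j k ∎
  where
  open ≡-Reasoning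
  onMonomial : ∀ {F} a b c → F ≋ monomial a b c → shift 1 0 0 F n j k ≡ monomial (1 + a) b c n j k
  onMonomial a b c F≋ = trans (shift-cong 1 0 0 F≋ n j k) (shift-monomial 1 0 0 a b c n j k)

rhs≋rhsShifts : X ⊛ X ⊛ Y ⊛ (𝟙 ⊟ V) ⊕ X ⊛ (𝟙 ⊕ X ⊛ Y ⊟ X ⊛ Y ⊛ V ⊛ V) ⊛ A₁ ≋ rhsShifts
rhs≋rhsShifts n j k = cong₂ _+ℤ_ (⊛-byMonomial 2 0 1 (𝟙 ⊟ V) XXY≋monomial n j k) (begin
  ((X ⊛ (𝟙 ⊕ X ⊛ Y ⊟ X ⊛ Y ⊛ V ⊛ V)) ⊛ A₁) n j k
    ≡⟨ ⊛-congˡ A₁ X⊛factor≋ n j k ⟩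
  ((monomial 1 0 0 ⊕ monomial 2 0 1 ⊟ monomial 2 2 1) ⊛ A₁) n j k
    ≡⟨ ⊛-distribʳ-⊟ (monomial 1 0 0 ⊕ monomial 2 0 1) (monomial 2 2 1) A₁ n j k ⟩
  ((monomial 1 0 0 ⊕ monomial 2 0 1) ⊛ A₁ ⊟ monomial 2 2 1 ⊛ A₁) n j k
    ≡⟨ cong₂ (λ a b → a +ℤ -ℤ b) (⊛-distribʳ-⊕ (monomial 1 0 0) (monomial 2 0 1) A₁ n j k) refl ⟩
  (monomial 1 0 0 ⊛ A₁ ⊕ monomial 2 0 1 ⊛ A₁ ⊟ monomial 2 2 1 ⊛ A₁) n j k
    ≡⟨ cong₂ (λ a b → a +ℤ -ℤ b) (cong₂ _+ℤ_ (monomial-⊛ 1 0 0 A₁ n j k) (monomial-⊛ 2 0 1 A₁ n j k)) (monomial-⊛ 2 2 1 A₁ n j k) ⟩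
  (shift 1 0 0 A₁ ⊕ shift 2 0 1 A₁ ⊟ shift 2 2 1 A₁) n j k ∎)
  where open ≡-Reasoning

-- [xᵐ yᵏ] of y · A(x,1)
yA₁ : ℕ → ℕ → ℤ
yA₁ m zero = + 0
yA₁ m (suc k) = A₁ m 0 k

aCoeff-2or3≡ : ∀ m i k → 2 ≤ i → i ≤ 3 → + aCoeff (3 + m) i k ≡ A₁ (2 + m) 0 k +ℤ yA₁ (1 + m) k
aCoeff-2or3≡ m i zero 2≤i i≤3 =
  trans (cong +_ (aCoeff-2or3-zero m i 2≤i i≤3)) (trans (sym (A₁≡aTail (2 + m) 0)) (sym (ℤ.+-identityʳ _)))
aCoeff-2or3≡ m i (suc k) 2≤i i≤3 =
  trans (cong +_ (aCoeff-2or3-suc m i k 2≤i i≤3)) (sym (cong₂ _+ℤ_ (A₁≡aTail (2 + m) (suc k)) (A₁≡aTail (1 + m) k)))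

2≤2 : 2 ≤ 2
2≤2 = ≤-refl

2≤3 : 2 ≤ 3
2≤3 = s≤s (s≤s z≤n)

column₀ : ∀ m k → lhsShifts (3 + m) 0 k ≡ rhsShifts (3 + m) 0 k
column₀ m k = begin
  lhsShifts (3 + m) 0 k                                  ≡⟨⟩
  (+ aCoeff (3 + m) 2 k +ℤ -ℤ + 0) +ℤ + 0                ≡⟨ cong (λ a → (a +ℤ -ℤ + 0) +ℤ + 0) (aCoeff-2or3≡ m 2 k 2≤2 2≤3) ⟩
  ((A₁ (2 + m) 0 k +ℤ yA₁ (1 + m) k) +ℤ -ℤ + 0) +ℤ + 0   ≡⟨ normalise (A₁ (2 + m) 0 k) (yA₁ (1 + m) k) ⟩
  + 0 +ℤ ((A₁ (2 + m) 0 k +ℤ yA₁ (1 + m) k) +ℤ -ℤ + 0)   ≡⟨ rhs k ⟨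
  rhsShifts (3 + m) 0 k                                  ∎
  where
  open ≡-Reasoning
  normalise = solve 2 (λ x y → ((x :+ y) :+ :- con (+ 0)) :+ con (+ 0) := con (+ 0) :+ ((x :+ y) :+ :- con (+ 0))) refl
  rhs : ∀ k → rhsShifts (3 + m) 0 k ≡ + 0 +ℤ ((A₁ (2 + m) 0 k +ℤ yA₁ (1 + m) k) +ℤ -ℤ + 0)
  rhs zero = refl
  rhs (suc k) = refl

column₁ : ∀ m k → lhsShifts (3 + m) 1 k ≡ rhsShifts (3 + m) 1 k
column₁ m k = begin
  lhsShifts (3 + m) 1 k                                  ≡⟨⟩
  (+ aCoeff (3 + m) 3 k +ℤ -ℤ + aCoeff (3 + m) 2 k) +ℤ + 0
    ≡⟨ cong₂ (λ a b → (a +ℤ -ℤ b) +ℤ + 0) (aCoeff-2or3≡ m 3 k 2≤3 ≤-refl) (aCoeff-2or3≡ m 2 k 2≤2 2≤3) ⟩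
  (a₂ +ℤ -ℤ a₂) +ℤ + 0                                   ≡⟨ solve 1 (λ x → (x :+ :- x) :+ con (+ 0) := con (+ 0)) refl a₂ ⟩
  + 0                                                    ≡⟨ rhs k ⟨
  rhsShifts (3 + m) 1 k                                  ∎
  where
  open ≡-Reasoning
  a₂ = A₁ (2 + m) 0 k +ℤ yA₁ (1 + m) k
  rhs : ∀ k → rhsShifts (3 + m) 1 k ≡ + 0
  rhs zero = refl
  rhs (suc k) = refl

column₂ : ∀ m k → lhsShifts (3 + m) 2 k ≡ rhsShifts (3 + m) 2 k
column₂ m k = begin
  lhsShifts (3 + m) 2 k                                                            ≡⟨⟩
  (+ aCoeff (3 + m) 4 k +ℤ -ℤ + aCoeff (3 + m) 3 k) +ℤ + aCoeff (2 + m) 2 k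
    ≡⟨ cong₂ (λ a b → (a +ℤ -ℤ b) +ℤ + aCoeff (2 + m) 2 k) (cong +_ (aCoeff-≥4 (2 + m) 4 k ≤-refl)) (aCoeff-2or3≡ m 3 k 2≤3 ≤-refl) ⟩
  (+ aTail (2 + m) 3 k +ℤ -ℤ (A₁ (2 + m) 0 k +ℤ yA₁ (1 + m) k)) +ℤ + aCoeff (2 + m) 2 k
    ≡⟨ cong (λ x → (+ aTail (2 + m) 3 k +ℤ -ℤ (x +ℤ yA₁ (1 + m) k)) +ℤ + aCoeff (2 + m) 2 k) (A₁-split (2 + m) k) ⟩
  (+ aTail (2 + m) 3 k +ℤ -ℤ ((+ aCoeff (2 + m) 2 k +ℤ + aTail (2 + m) 3 k) +ℤ yA₁ (1 + m) k)) +ℤ + aCoeff (2 + m) 2 k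
    ≡⟨ normalise (+ aTail (2 + m) 3 k) (+ aCoeff (2 + m) 2 k) (yA₁ (1 + m) k) ⟩
  + 0 +ℤ ((+ 0 +ℤ + 0) +ℤ -ℤ yA₁ (1 + m) k)                                        ≡⟨ rhs k ⟨
  rhsShifts (3 + m) 2 k                                                            ∎
  where
  open ≡-Reasoning
  A₁-split : ∀ m k → A₁ m 0 k ≡ + aCoeff m 2 k +ℤ + aTail m 3 k
  A₁-split m k = trans (A₁≡aTail m k) (cong +_ (aTail-split m 2 k))
  normalise = solve 3 (λ t a y → (t :+ :- ((a :+ t) :+ y)) :+ a := con (+ 0) :+ ((con (+ 0) :+ con (+ 0)) :+ :- y)) refl
  rhs : ∀ k → rhsShifts (3 + m) 2 k ≡ + 0 +ℤ ((+ 0 +ℤ + 0) +ℤ -ℤ yA₁ (1 + m) k)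
  rhs zero = refl
  rhs (suc k) = refl

column₃₊ : ∀ m j k → lhsShifts (3 + m) (3 + j) k ≡ rhsShifts (3 + m) (3 + j) k
column₃₊ m j k = begin
  lhsShifts (3 + m) (3 + j) k                                                                        ≡⟨⟩
  (+ aCoeff (3 + m) (3 + j + 2) k +ℤ -ℤ + aCoeff (3 + m) (2 + j + 2) k) +ℤ + aCoeff (2 + m) (1 + j + 2) k
    ≡⟨ cong₂ (λ a b → (+ a +ℤ -ℤ + b) +ℤ + aCoeff (2 + m) (1 + j + 2) k) (aCoeff-≥4 (2 + m) (3 + j + 2) k 4≤5+j) (aCoeff-≥4 (2 + m) (2 + j + 2) k 4≤4+j) ⟩
  (+ aTail (2 + m) (2 + j + 2) k +ℤ -ℤ + aTail (2 + m) (1 + j + 2) k) +ℤ + aCoeff (2 + m) (1 + j + 2) k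
    ≡⟨ cong (λ b → (+ aTail (2 + m) (2 + j + 2) k +ℤ -ℤ + b) +ℤ + aCoeff (2 + m) (1 + j + 2) k) (aTail-split (2 + m) (1 + j + 2) k) ⟩
  (+ aTail (2 + m) (2 + j + 2) k +ℤ -ℤ (+ aCoeff (2 + m) (1 + j + 2) k +ℤ + aTail (2 + m) (2 + j + 2) k)) +ℤ + aCoeff (2 + m) (1 + j + 2) k
    ≡⟨ normalise (+ aTail (2 + m) (2 + j + 2) k) (+ aCoeff (2 + m) (1 + j + 2) k) ⟩
  + 0                                                                                                ≡⟨ rhs k ⟨
  rhsShifts (3 + m) (3 + j) k                                                                        ∎
  where
  open ≡-Reasoning
  4≤4+j : 4 ≤ 2 + j + 2
  4≤4+j = s≤s (s≤s (m≤n+m 2 j))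
  4≤5+j : 4 ≤ 3 + j + 2
  4≤5+j = ≤-trans 4≤4+j (n≤1+n _)
  normalise = solve 2 (λ t a → (t :+ :- (a :+ t)) :+ a := con (+ 0)) refl
  rhs : ∀ k → rhsShifts (3 + m) (3 + j) k ≡ + 0
  rhs zero = refl
  rhs (suc k) = refl

column-small : ∀ j k → lhsShifts 2 (2 + j) k ≡ rhsShifts 2 (2 + j) k
column-small j k = begin
  lhsShifts 2 (2 + j) k                                                ≡⟨⟩
  (+ aCoeff 2 (2 + j + 2) k +ℤ -ℤ + aCoeff 2 (1 + j + 2) k) +ℤ + 0
    ≡⟨ cong₂ (λ a b → (+ a +ℤ -ℤ + b) +ℤ + 0) (aCoeff-beyond 2 (2 + j + 2) k (s≤s (s≤s (≤-trans (s≤s z≤n) (m≤n+m 2 j))))) (aCoeff-beyond 2 (1 + j + 2) k (s≤s (m≤n+m 2 j))) ⟩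
  + 0                                                                  ≡⟨ rhs j k ⟨
  rhsShifts 2 (2 + j) k                                                ∎
  where
  open ≡-Reasoning
  rhs : ∀ j k → rhsShifts 2 (2 + j) k ≡ + 0
  rhs j zero = refl
  rhs zero (suc k) = refl
  rhs (suc j) (suc k) = refl

coefficients : lhsShifts ≋ rhsShifts
coefficients 0 0 k = refl
coefficients 0 (suc j) k = refl
coefficients 1 0 k = refl
coefficients 1 1 k = refl
coefficients 1 (suc (suc j)) k = refl
coefficients 2 0 0 = refl
coefficients 2 0 1 = refl
coefficients 2 0 (suc (suc k)) = refl
coefficients 2 1 0 = refl
coefficients 2 1 1 = refl
coefficients 2 1 (suc (suc k)) = refl
coefficients 2 (suc (suc j)) k = column-small j k
coefficients (suc (suc (suc m))) 0 k = column₀ m k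
coefficients (suc (suc (suc m))) 1 k = column₁ m k
coefficients (suc (suc (suc m))) 2 k = column₂ m k
coefficients (suc (suc (suc m))) (suc (suc (suc j))) k = column₃₊ m j k

lemma2p3 : ∀ n j k →
    ((𝟙 ⊟ V ⊕ X ⊛ V ⊛ V) ⊛ A) n j k
    ≡ (X ⊛ X ⊛ Y ⊛ (𝟙 ⊟ V) ⊕ X ⊛ (𝟙 ⊕ X ⊛ Y ⊟ X ⊛ Y ⊛ V ⊛ V) ⊛ A₁) n j k
lemma2p3 n j k = begin
  ((𝟙 ⊟ V ⊕ X ⊛ V ⊛ V) ⊛ A) n j k                                        ≡⟨ lhs≋lhsShifts n j k ⟩
  lhsShifts n j k                                                        ≡⟨ coefficients n j k ⟩
  rhsShifts n j k                                                        ≡⟨ rhs≋rhsShifts n j k ⟨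
  (X ⊛ X ⊛ Y ⊛ (𝟙 ⊟ V) ⊕ X ⊛ (𝟙 ⊕ X ⊛ Y ⊟ X ⊛ Y ⊛ V ⊛ V) ⊛ A₁) n j k    ∎
  where open ≡-Reasoning
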